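{- Let $B_n$ denote the Bernoulli numbers, defined by $\sum_{n\ge0}B_n\frac{x^n}{n!}=\frac{x}{e^x-1}$, and set $\tilde B_n=(n+1)B_n$. Then for every nonnegative integer $n$, \begin{align*} \frac1{n+1}\sum_{i=0}^{n+1}2^{n+1-i}\binom{n+1}i\tilde B_{n+i}&=(-1)^n,\\ \frac1{n+1}\sum_{i=0}^{n+1}3^{n+1-i}\binom{n+1}i\tilde B_{n+i}&=(-2)^{n-1}(n-4),\\ \frac1{n+1}\sum_{i=0}^{n+1}4^{n+1-i}\binom{n+1}i\tilde B_{n+i}&=(-1)^n\bigl(4^n+(2-\tfrac43 n)3^n\bigr), \end{align*} and in general, for every positive integer $k$, \[\frac1{n+1}\sum_{i=0}^{n+1}k^{n+1-i}\binom{n+1}i\tilde B_{n+i}=\sum_{i=1}^{k-1}\bigl((2n+1)i-(n+1)k\bigr)\,i^n(i-k)^{n-1}.\]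
   Context: Powers with negative exponent (e.g. $(i-k)^{ -1}$ when $n=0$) are interpreted as rational numbers. -}

module Defs where

open import Data.Nat as ℕ using (ℕ; zero; suc; _!)
open import Data.Nat.Properties using (_!≢0)
open import Data.Integer as ℤ using (ℤ; +_; -[1+_])
open import Data.Rational as ℚ using (ℚ; 0ℚ; 1ℚ; _+_; _*_; -_; 1/_; _/_)
open import Data.Rational.Properties using (_≟_)
open import Data.List using (List; []; _∷_)
open import Relation.Nullary using (yes; no)

ℕ→ℚ : ℕ → ℚ
ℕ→ℚ n = (+ n) / 1

ℤ→ℚ : ℤ → ℚ
ℤ→ℚ z = z / 1

_^ℕ_ : ℚ → ℕ → ℚ
q ^ℕ zero = 1ℚ
q ^ℕ suc n = q * (q ^ℕ n)

-- integer power in ℚ; q^(-m) = 1 / q^m.  (Convention 0^(-m) = 0 is never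
-- used in the theorem, where negative exponents only hit nonzero bases.)
_^ℤ_ : ℚ → ℤ → ℚ
q ^ℤ (+ n) = q ^ℕ n
q ^ℤ -[1+ m ] with (q ^ℕ suc m) ≟ 0ℚ
... | yes _ = 0ℚ
... | no p≢0 = 1/_ (q ^ℕ suc m) {{ℚ.≢-nonZero p≢0}}

Σ< : ℕ → (ℕ → ℚ) → ℚ
Σ< zero f = 0ℚ
Σ< (suc n) f = Σ< n f + f n

-- Σ_{i=a}^{b} f i  (inclusive; empty if b < a)
ΣFromTo : ℕ → ℕ → (ℕ → ℚ) → ℚ
ΣFromTo a b f = Σ< (suc b ℕ.∸ a) (λ j → f (a ℕ.+ j))

-- Formal power series as coefficient sequences ℕ → ℚ.
-- Reciprocal of a power series a with constant term a 0 = 1: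
-- b 0 = 1,  b n = - Σ_{j=1}^{n} a j * b (n - j).
-- recipList a n = [b n, b (n-1), ..., b 0]
private
  dotShift : (ℕ → ℚ) → ℕ → List ℚ → ℚ
  dotShift a p [] = 0ℚ
  dotShift a p (x ∷ xs) = a (suc p) * x + dotShift a (suc p) xs

recipList : (ℕ → ℚ) → ℕ → List ℚ
recipList a zero = 1ℚ ∷ []
recipList a (suc n) = (- dotShift a 0 (recipList a n)) ∷ recipList a n

recip : (ℕ → ℚ) → ℕ → ℚ
recip a n with recipList a n
... | [] = 0ℚ
... | x ∷ _ = x

-- (e^x - 1)/x = Σ_n x^n / (n+1)!
expm1-over-x : ℕ → ℚ
expm1-over-x n = _/_ (+ 1) (suc n !) {{suc n !≢0}}

-- Bernoulli numbers: Σ B_n x^n / n! = x / (e^x - 1) = 1 / ((e^x - 1)/x)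
B : ℕ → ℚ
B n = ℕ→ℚ (n !) * recip expm1-over-x n

B̃ : ℕ → ℚ
B̃ n = ℕ→ℚ (suc n) * B n

LHS : ℕ → ℕ → ℚ
LHS k n = _/_ (+ 1) (suc n) *
  ΣFromTo 0 (suc n) (λ i → (ℕ→ℚ k ^ℕ (suc n ℕ.∸ i)) * ℕ→ℚ (suc n C i) * B̃ (n ℕ.+ i))
  where open import Data.Nat.Combinatorics using (_C_)

-- Let Λ be the linear functional on ℚ[x] with Λ(xʲ) = Bⱼ.  The Bernoulli recurrence
-- Σ_{j<s} C(s,j) Bⱼ = [s = 1] says Λ(p(x+1)) = Λ(p) + p′(0), and the vanishing of the odd
-- Bernoulli numbers beyond B₁ says Λ(p(−x)) = Λ(p) + p′(0).  Writing B̃ₙ₊ᵢ = (n+1+i) Bₙ₊ᵢ and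
-- i C(n+1,i) = (n+1) C(n,i−1), the left-hand side is Λ(g) + Λ(h) with g = xⁿ⁺¹(x+k)ⁿ and
-- h = xⁿ(x+k)ⁿ⁺¹.  With Wᵢ = (x+i)ⁿ⁺¹(x+i−k)ⁿ we have h = W_k and Wᵢ(x+1) = Wᵢ₊₁, so
-- Λ(h) = Λ(W₀) + Σ_{i<k} Wᵢ′(0); and g(−x) = −W₀(x) gives Λ(g) + W₀′(0) = −Λ(W₀).  Hence the
-- left-hand side is Σ_{0<i<k} Wᵢ′(0), which the product rule turns into the stated sum.
-- Polynomial identities reach Λ because a polynomial vanishing on ℕ has zero coefficients.

{-# OPTIONS --safe #-}
module Submission where

open import Defs
open import Data.Nat as ℕ using (ℕ; suc; _≤_; zero; _<_; _∸_; _!; _⊔_; z≤n; s≤s)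
open import Data.Integer as ℤ using (+_; -[1+_])
open import Data.Rational as ℚ using (ℚ; 1ℚ; _+_; _-_; _*_; -_; _/_; 0ℚ; mkℚ)
open import Data.Product using (_×_; _,_)
open import Relation.Binary.PropositionalEquality
  using (_≡_; _≢_; _≗_; refl; sym; trans; cong; cong₂; subst₂; module ≡-Reasoning)

import Data.Nat.Properties as ℕₚ
open import Data.Nat.Combinatorics
  using (_C_; nCn≡1; nC1≡n; k>n⇒nCk≡0; nCk≡nC[n∸k]; nCk≡n!/k![n-k]!; k![n∸k]!∣n!; nCk+nC[k+1]≡[n+1]C[k+1])
open import Data.Nat.DivMod using (m/n*n≡m)
open import Data.Nat.Coprimality using (1-coprimeTo) renaming (sym to coprime-sym)
open import Data.Nat.Induction using (<-rec)
import Data.Nat.Tactic.RingSolver as ℕ-Solver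
import Data.Integer.Properties as ℤₚ
import Data.Rational.Properties as ℚₚ
open import Data.List using (List; []; _∷_; length)
open import Data.Empty using (⊥-elim)
open import Function using (_∘_)
open import Level using (0ℓ)
open import Relation.Nullary using (yes; no)
open import Relation.Nullary.Decidable.Core using (dec⇒maybe)
open import Tactic.RingSolver using (solve-∀)
open import Tactic.RingSolver.Core.AlmostCommutativeRing using (AlmostCommutativeRing; fromCommutativeRing)

open ≡-Reasoning

ℚ-ring : AlmostCommutativeRing 0ℓ 0ℓ
ℚ-ring = fromCommutativeRing ℚₚ.+-*-commutativeRing (λ x → dec⇒maybe (0ℚ ℚₚ.≟ x))

ℕ→ℚ≡mkℚ : ∀ n → ℕ→ℚ n ≡ mkℚ (+ n) 0 (coprime-sym (1-coprimeTo n))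
ℕ→ℚ≡mkℚ n = ℚₚ.normalize-coprime (coprime-sym (1-coprimeTo n))

ℕ→ℚ-suc : ∀ n → ℕ→ℚ (suc n) ≡ 1ℚ + ℕ→ℚ n
ℕ→ℚ-suc n = sym (begin
  1ℚ + ℕ→ℚ n                 ≡⟨ cong (λ z → 1ℚ + z) (ℕ→ℚ≡mkℚ n) ⟩
  (+ 1 ℤ.+ + n ℤ.* + 1) / 1  ≡⟨ cong (λ z → (+ 1 ℤ.+ z) / 1) (ℤₚ.*-identityʳ (+ n)) ⟩
  ℕ→ℚ (suc n)                ∎)

ℕ→ℚ-+ : ∀ m n → ℕ→ℚ (m ℕ.+ n) ≡ ℕ→ℚ m + ℕ→ℚ n
ℕ→ℚ-+ zero    n = sym (ℚₚ.+-identityˡ (ℕ→ℚ n))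
ℕ→ℚ-+ (suc m) n = begin
  ℕ→ℚ (suc (m ℕ.+ n))   ≡⟨ ℕ→ℚ-suc (m ℕ.+ n) ⟩
  1ℚ + ℕ→ℚ (m ℕ.+ n)    ≡⟨ cong (λ z → 1ℚ + z) (ℕ→ℚ-+ m n) ⟩
  1ℚ + (ℕ→ℚ m + ℕ→ℚ n)  ≡⟨ ℚₚ.+-assoc 1ℚ (ℕ→ℚ m) (ℕ→ℚ n) ⟨
  1ℚ + ℕ→ℚ m + ℕ→ℚ n    ≡⟨ cong (_+ ℕ→ℚ n) (ℕ→ℚ-suc m) ⟨
  ℕ→ℚ (suc m) + ℕ→ℚ n   ∎

ℕ→ℚ-* : ∀ m n → ℕ→ℚ (m ℕ.* n) ≡ ℕ→ℚ m * ℕ→ℚ n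
ℕ→ℚ-* zero    n = sym (ℚₚ.*-zeroˡ (ℕ→ℚ n))
ℕ→ℚ-* (suc m) n = begin
  ℕ→ℚ (n ℕ.+ m ℕ.* n)     ≡⟨ ℕ→ℚ-+ n (m ℕ.* n) ⟩
  ℕ→ℚ n + ℕ→ℚ (m ℕ.* n)   ≡⟨ cong (λ z → ℕ→ℚ n + z) (ℕ→ℚ-* m n) ⟩
  ℕ→ℚ n + ℕ→ℚ m * ℕ→ℚ n   ≡⟨ 1+m*n (ℕ→ℚ m) (ℕ→ℚ n) ⟩
  (1ℚ + ℕ→ℚ m) * ℕ→ℚ n    ≡⟨ cong (_* ℕ→ℚ n) (ℕ→ℚ-suc m) ⟨
  ℕ→ℚ (suc m) * ℕ→ℚ n     ∎
  where
  1+m*n : ∀ (m n : ℚ) → n + m * n ≡ (1ℚ + m) * n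
  1+m*n = solve-∀ ℚ-ring

ℕ→ℚ-2n+1 : ∀ n → ℕ→ℚ (2 ℕ.* n ℕ.+ 1) ≡ ℕ→ℚ 2 * ℕ→ℚ n + 1ℚ
ℕ→ℚ-2n+1 n = trans (ℕ→ℚ-+ (2 ℕ.* n) 1) (cong (_+ 1ℚ) (ℕ→ℚ-* 2 n))

ℕ→ℚ-injective : ∀ {m n} → ℕ→ℚ m ≡ ℕ→ℚ n → m ≡ n
ℕ→ℚ-injective {m} {n} eq =
  ℤₚ.+-injective (cong ℚ.numerator (trans (sym (ℕ→ℚ≡mkℚ m)) (trans eq (ℕ→ℚ≡mkℚ n))))

ℕ→ℚ-*-1/ : ∀ d .{{_ : ℕ.NonZero d}} → ℕ→ℚ d * (+ 1 / d) ≡ 1ℚ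
ℕ→ℚ-*-1/ (suc d) =
  trans (cong₂ _*_ (ℕ→ℚ≡mkℚ (suc d)) (ℚₚ.normalize-coprime (1-coprimeTo (suc d))))
        (ℚₚ.*-inverseʳ (mkℚ (+ suc d) 0 (coprime-sym (1-coprimeTo (suc d)))))

ℕ→ℚ-suc-*-cancelˡ : ∀ d {x y} → ℕ→ℚ (suc d) * x ≡ ℕ→ℚ (suc d) * y → x ≡ y
ℕ→ℚ-suc-*-cancelˡ d {x} {y} eq = begin
  x                                   ≡⟨ undo x ⟨
  (+ 1 / suc d) * (ℕ→ℚ (suc d) * x)   ≡⟨ cong ((+ 1 / suc d) *_) eq ⟩
  (+ 1 / suc d) * (ℕ→ℚ (suc d) * y)   ≡⟨ undo y ⟩
  y                                   ∎
  where
  swap : ∀ (u v z : ℚ) → u * (v * z) ≡ (v * u) * z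
  swap = solve-∀ ℚ-ring
  undo : ∀ z → (+ 1 / suc d) * (ℕ→ℚ (suc d) * z) ≡ z
  undo z = trans (swap (+ 1 / suc d) (ℕ→ℚ (suc d)) z) (trans (cong (_* z) (ℕ→ℚ-*-1/ (suc d))) (ℚₚ.*-identityˡ z))

Σ<-cong : ∀ n {f g : ℕ → ℚ} → (∀ i → i < n → f i ≡ g i) → Σ< n f ≡ Σ< n g
Σ<-cong zero    eq = refl
Σ<-cong (suc n) eq = cong₂ _+_ (Σ<-cong n (λ i i<n → eq i (ℕₚ.m<n⇒m<1+n i<n))) (eq n ℕₚ.≤-refl)

Σ<-+ : ∀ n (f g : ℕ → ℚ) → Σ< n (λ i → f i + g i) ≡ Σ< n f + Σ< n g
Σ<-+ zero    f g = sym (ℚₚ.+-identityˡ 0ℚ)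
Σ<-+ (suc n) f g = trans (cong (_+ (f n + g n)) (Σ<-+ n f g)) (interchange (Σ< n f) (Σ< n g) (f n) (g n))
  where
  interchange : ∀ (a b c d : ℚ) → (a + b) + (c + d) ≡ (a + c) + (b + d)
  interchange = solve-∀ ℚ-ring

*-distribˡ-Σ< : ∀ n c (f : ℕ → ℚ) → c * Σ< n f ≡ Σ< n (λ i → c * f i)
*-distribˡ-Σ< zero    c f = ℚₚ.*-zeroʳ c
*-distribˡ-Σ< (suc n) c f = trans (ℚₚ.*-distribˡ-+ c _ _) (cong (_+ c * f n) (*-distribˡ-Σ< n c f))

Σ<-first : ∀ n (f : ℕ → ℚ) → Σ< (suc n) f ≡ f 0 + Σ< n (f ∘ suc)
Σ<-first zero    f = trans (ℚₚ.+-identityˡ (f 0)) (sym (ℚₚ.+-identityʳ (f 0)))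
Σ<-first (suc n) f = trans (cong (_+ f (suc n)) (Σ<-first n f)) (ℚₚ.+-assoc (f 0) _ (f (suc n)))

Σ<-reverse : ∀ n (F : ℕ → ℕ → ℚ) → Σ< (suc n) (λ j → F j (n ∸ j)) ≡ Σ< (suc n) (λ i → F (n ∸ i) i)
Σ<-reverse zero    F = refl
Σ<-reverse (suc n) F = begin
  Σ< (suc (suc n)) (λ j → F j (suc n ∸ j))
    ≡⟨ Σ<-first (suc n) (λ j → F j (suc n ∸ j)) ⟩
  F 0 (suc n) + Σ< (suc n) (λ j → F (suc j) (n ∸ j))
    ≡⟨ cong (λ z → F 0 (suc n) + z) (Σ<-reverse n (F ∘ suc)) ⟩
  F 0 (suc n) + Σ< (suc n) (λ i → F (suc (n ∸ i)) i)
    ≡⟨ ℚₚ.+-comm (F 0 (suc n)) _ ⟩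
  Σ< (suc n) (λ i → F (suc (n ∸ i)) i) + F 0 (suc n)
    ≡⟨ cong₂ _+_ (Σ<-cong (suc n) (λ i i≤n → cong (λ j → F j i) (sym (ℕₚ.+-∸-assoc 1 (ℕₚ.≤-pred i≤n)))))
                 (cong (λ j → F j (suc n)) (sym (ℕₚ.n∸n≡0 n))) ⟩
  Σ< (suc (suc n)) (λ i → F (suc n ∸ i) i) ∎

δ₁ : ℕ → ℚ
δ₁ (suc zero) = 1ℚ
δ₁ _          = 0ℚ

Σ<-δ₁ : ∀ n (c : ℕ → ℚ) → Σ< (suc (suc n)) (λ j → c j * δ₁ j) ≡ c 1
Σ<-δ₁ zero    c = first-two (c 0) (c 1)
  where
  first-two : ∀ (a b : ℚ) → 0ℚ + a * 0ℚ + b * 1ℚ ≡ b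
  first-two = solve-∀ ℚ-ring
Σ<-δ₁ (suc n) c = trans (cong (_+ c (suc (suc n)) * 0ℚ) (Σ<-δ₁ n c)) (vanishing (c 1) (c (suc (suc n))))
  where
  vanishing : ∀ (a b : ℚ) → a + b * 0ℚ ≡ a
  vanishing = solve-∀ ℚ-ring

^ℕ-+ : ∀ q m n → q ^ℕ (m ℕ.+ n) ≡ q ^ℕ m * q ^ℕ n
^ℕ-+ q zero    n = sym (ℚₚ.*-identityˡ _)
^ℕ-+ q (suc m) n = trans (cong (q *_) (^ℕ-+ q m n)) (sym (ℚₚ.*-assoc q _ _))

^ℕ-distrib-* : ∀ p q n → (p * q) ^ℕ n ≡ p ^ℕ n * q ^ℕ n
^ℕ-distrib-* p q zero    = refl
^ℕ-distrib-* p q (suc n) = trans (cong ((p * q) *_) (^ℕ-distrib-* p q n)) (interchange p q (p ^ℕ n) (q ^ℕ n))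
  where
  interchange : ∀ (a b c d : ℚ) → (a * b) * (c * d) ≡ (a * c) * (b * d)
  interchange = solve-∀ ℚ-ring

1^ℕ : ∀ n → 1ℚ ^ℕ n ≡ 1ℚ
1^ℕ zero    = refl
1^ℕ (suc n) = trans (ℚₚ.*-identityˡ _) (1^ℕ n)

-1^ℕ-square : ∀ n → (- 1ℚ) ^ℕ n * (- 1ℚ) ^ℕ n ≡ 1ℚ
-1^ℕ-square zero    = refl
-1^ℕ-square (suc n) = trans (signs ((- 1ℚ) ^ℕ n)) (-1^ℕ-square n)
  where
  signs : ∀ (u : ℚ) → (- 1ℚ * u) * (- 1ℚ * u) ≡ u * u
  signs = solve-∀ ℚ-ring

-1^ℕ-∸ : ∀ {n j} → j ≤ n → (- 1ℚ) ^ℕ n * (- 1ℚ) ^ℕ (n ∸ j) ≡ (- 1ℚ) ^ℕ j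
-1^ℕ-∸ {n} {j} j≤n = begin
  σ n * σ (n ∸ j)                  ≡⟨ cong (λ m → σ m * σ (n ∸ j)) (ℕₚ.m∸n+n≡m j≤n) ⟨
  σ (n ∸ j ℕ.+ j) * σ (n ∸ j)      ≡⟨ cong (_* σ (n ∸ j)) (^ℕ-+ (- 1ℚ) (n ∸ j) j) ⟩
  σ (n ∸ j) * σ j * σ (n ∸ j)      ≡⟨ regroup (σ (n ∸ j)) (σ j) ⟩
  σ (n ∸ j) * σ (n ∸ j) * σ j      ≡⟨ cong (_* σ j) (-1^ℕ-square (n ∸ j)) ⟩
  1ℚ * σ j                         ≡⟨ ℚₚ.*-identityˡ (σ j) ⟩
  σ j                              ∎
  where
  σ : ℕ → ℚ
  σ m = (- 1ℚ) ^ℕ m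
  regroup : ∀ (u v : ℚ) → u * v * u ≡ u * u * v
  regroup = solve-∀ ℚ-ring

c*c^[m∸1+j]≡c^[m∸j] : ∀ c {m j} → suc j ≤ m → c * c ^ℕ (m ∸ suc j) ≡ c ^ℕ (m ∸ j)
c*c^[m∸1+j]≡c^[m∸j] c {suc m} {j} (s≤s j≤m) = cong (c ^ℕ_) (sym (ℕₚ.+-∸-assoc 1 j≤m))

^ℤ-inverse : ∀ q m → q ^ℕ suc m ≢ 0ℚ → q ^ℕ suc m * q ^ℤ -[1+ m ] ≡ 1ℚ
^ℤ-inverse q m q^≢0 with q ^ℕ suc m ℚₚ.≟ 0ℚ
... | yes q^≡0 = ⊥-elim (q^≢0 q^≡0)
... | no  q^≢0′ = ℚₚ.*-inverseʳ (q ^ℕ suc m) {{ℚ.≢-nonZero q^≢0′}}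

nCk*k!*[n∸k]!≡n! : ∀ {n k} → k ≤ n → (n C k) ℕ.* (k ! ℕ.* (n ∸ k) !) ≡ n !
nCk*k!*[n∸k]!≡n! {n} {k} k≤n =
  trans (cong (ℕ._* (k ! ℕ.* (n ∸ k) !)) (nCk≡n!/k![n-k]! k≤n))
        (m/n*n≡m {{k ℕₚ.!* (n ∸ k) !≢0}} (k![n∸k]!∣n! k≤n))

[1+k]*[1+n]C[1+k]≡[1+n]*nCk : ∀ n k → suc k ℕ.* (suc n C suc k) ≡ suc n ℕ.* (n C k)
[1+k]*[1+n]C[1+k]≡[1+n]*nCk n k with k ℕₚ.≤? n
... | yes k≤n = ℕₚ.*-cancelʳ-≡ _ _ (k ! ℕ.* (n ∸ k) !) {{k ℕₚ.!* (n ∸ k) !≢0}} (begin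
  suc k ℕ.* (suc n C suc k) ℕ.* (k ! ℕ.* (n ∸ k) !)    ≡⟨ regroup (suc k) (suc n C suc k) (k !) ((n ∸ k) !) ⟩
  (suc n C suc k) ℕ.* (suc k ! ℕ.* (n ∸ k) !)          ≡⟨ nCk*k!*[n∸k]!≡n! (s≤s k≤n) ⟩
  suc n !                                              ≡⟨ cong (suc n ℕ.*_) (nCk*k!*[n∸k]!≡n! k≤n) ⟨
  suc n ℕ.* ((n C k) ℕ.* (k ! ℕ.* (n ∸ k) !))          ≡⟨ ℕₚ.*-assoc (suc n) (n C k) (k ! ℕ.* (n ∸ k) !) ⟨
  suc n ℕ.* (n C k) ℕ.* (k ! ℕ.* (n ∸ k) !)            ∎)
  where
  regroup : ∀ a b c d → a ℕ.* b ℕ.* (c ℕ.* d) ≡ b ℕ.* (a ℕ.* c ℕ.* d)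
  regroup = ℕ-Solver.solve-∀
... | no  k≰n rewrite k>n⇒nCk≡0 (ℕₚ.≰⇒> k≰n) | k>n⇒nCk≡0 (s≤s (ℕₚ.≰⇒> k≰n)) =
  trans (ℕₚ.*-zeroʳ (suc k)) (sym (ℕₚ.*-zeroʳ (suc n)))

-- Polynomials

Poly : Set
Poly = List ℚ

coeff : Poly → ℕ → ℚ
coeff []      _       = 0ℚ
coeff (a ∷ p) zero    = a
coeff (a ∷ p) (suc j) = coeff p j

eval : Poly → ℚ → ℚ
eval []      x = 0ℚ
eval (a ∷ p) x = a + x * eval p x

infixl 6 _⊕_
infixr 7 _⊙_
infixl 7 _⊗_
infix  8 [x+_]^_ x^_·_

_⊕_ : Poly → Poly → Poly
[]      ⊕ q       = q
(a ∷ p) ⊕ []      = a ∷ p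
(a ∷ p) ⊕ (b ∷ q) = a + b ∷ p ⊕ q

_⊙_ : ℚ → Poly → Poly
c ⊙ []      = []
c ⊙ (a ∷ p) = c * a ∷ c ⊙ p

_⊗_ : Poly → Poly → Poly
[]      ⊗ q = []
(a ∷ p) ⊗ q = a ⊙ q ⊕ (0ℚ ∷ p ⊗ q)

x^_·_ : ℕ → Poly → Poly
x^ zero  · p = p
x^ suc a · p = 0ℚ ∷ x^ a · p

[x+_]^_ : ℚ → ℕ → Poly
[x+ c ]^ zero  = 1ℚ ∷ []
[x+ c ]^ suc m = c ⊙ [x+ c ]^ m ⊕ (0ℚ ∷ [x+ c ]^ m)

eval-⊕ : ∀ p q x → eval (p ⊕ q) x ≡ eval p x + eval q x
eval-⊕ []      q       x = sym (ℚₚ.+-identityˡ _)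
eval-⊕ (a ∷ p) []      x = sym (ℚₚ.+-identityʳ _)
eval-⊕ (a ∷ p) (b ∷ q) x = trans (cong (λ z → a + b + x * z) (eval-⊕ p q x)) (regroup a b x (eval p x) (eval q x))
  where
  regroup : ∀ (a b x u v : ℚ) → a + b + x * (u + v) ≡ (a + x * u) + (b + x * v)
  regroup = solve-∀ ℚ-ring

eval-⊙ : ∀ c p x → eval (c ⊙ p) x ≡ c * eval p x
eval-⊙ c []      x = sym (ℚₚ.*-zeroʳ c)
eval-⊙ c (a ∷ p) x = trans (cong (λ z → c * a + x * z) (eval-⊙ c p x)) (regroup c a x (eval p x))
  where
  regroup : ∀ (c a x u : ℚ) → c * a + x * (c * u) ≡ c * (a + x * u)
  regroup = solve-∀ ℚ-ring

eval-⊗ : ∀ p q x → eval (p ⊗ q) x ≡ eval p x * eval q x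
eval-⊗ []      q x = sym (ℚₚ.*-zeroˡ (eval q x))
eval-⊗ (a ∷ p) q x = begin
  eval (a ⊙ q ⊕ (0ℚ ∷ p ⊗ q)) x             ≡⟨ eval-⊕ (a ⊙ q) (0ℚ ∷ p ⊗ q) x ⟩
  eval (a ⊙ q) x + (0ℚ + x * eval (p ⊗ q) x)  ≡⟨ cong₂ (λ u v → u + (0ℚ + x * v)) (eval-⊙ a q x) (eval-⊗ p q x) ⟩
  a * eval q x + (0ℚ + x * (eval p x * eval q x)) ≡⟨ regroup a x (eval p x) (eval q x) ⟩
  (a + x * eval p x) * eval q x               ∎
  where
  regroup : ∀ (a x u v : ℚ) → a * v + (0ℚ + x * (u * v)) ≡ (a + x * u) * v
  regroup = solve-∀ ℚ-ring

eval-x^· : ∀ a p x → eval (x^ a · p) x ≡ x ^ℕ a * eval p x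
eval-x^· zero    p x = sym (ℚₚ.*-identityˡ _)
eval-x^· (suc a) p x =
  trans (ℚₚ.+-identityˡ _) (trans (cong (x *_) (eval-x^· a p x)) (sym (ℚₚ.*-assoc x (x ^ℕ a) (eval p x))))

eval-[x+]^ : ∀ c m x → eval ([x+ c ]^ m) x ≡ (x + c) ^ℕ m
eval-[x+]^ c zero    x = trans (cong (λ z → 1ℚ + z) (ℚₚ.*-zeroʳ x)) (ℚₚ.+-identityʳ 1ℚ)
eval-[x+]^ c (suc m) x = begin
  eval (c ⊙ [x+ c ]^ m ⊕ (0ℚ ∷ [x+ c ]^ m)) x
    ≡⟨ eval-⊕ (c ⊙ [x+ c ]^ m) (0ℚ ∷ [x+ c ]^ m) x ⟩
  eval (c ⊙ [x+ c ]^ m) x + (0ℚ + x * eval ([x+ c ]^ m) x)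
    ≡⟨ cong₂ (λ u v → u + (0ℚ + x * v)) (trans (eval-⊙ c ([x+ c ]^ m) x) (cong (c *_) (eval-[x+]^ c m x))) (eval-[x+]^ c m x) ⟩
  c * (x + c) ^ℕ m + (0ℚ + x * (x + c) ^ℕ m)
    ≡⟨ regroup c x ((x + c) ^ℕ m) ⟩
  (x + c) ^ℕ suc m ∎
  where
  regroup : ∀ (c x u : ℚ) → c * u + (0ℚ + x * u) ≡ (x + c) * u
  regroup = solve-∀ ℚ-ring

coeff-⊕ : ∀ p q j → coeff (p ⊕ q) j ≡ coeff p j + coeff q j
coeff-⊕ []      q       j       = sym (ℚₚ.+-identityˡ _)
coeff-⊕ (a ∷ p) []      zero    = sym (ℚₚ.+-identityʳ _)
coeff-⊕ (a ∷ p) []      (suc j) = sym (ℚₚ.+-identityʳ _)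
coeff-⊕ (a ∷ p) (b ∷ q) zero    = refl
coeff-⊕ (a ∷ p) (b ∷ q) (suc j) = coeff-⊕ p q j

coeff-⊙ : ∀ c p j → coeff (c ⊙ p) j ≡ c * coeff p j
coeff-⊙ c []      j       = sym (ℚₚ.*-zeroʳ c)
coeff-⊙ c (a ∷ p) zero    = refl
coeff-⊙ c (a ∷ p) (suc j) = coeff-⊙ c p j

coeff0-⊗ : ∀ p q → coeff (p ⊗ q) 0 ≡ coeff p 0 * coeff q 0
coeff0-⊗ []      q = sym (ℚₚ.*-zeroˡ (coeff q 0))
coeff0-⊗ (a ∷ p) q = trans (coeff-⊕ (a ⊙ q) (0ℚ ∷ p ⊗ q) 0) (trans (ℚₚ.+-identityʳ _) (coeff-⊙ a q 0))

coeff1-⊗ : ∀ p q → coeff (p ⊗ q) 1 ≡ coeff p 0 * coeff q 1 + coeff p 1 * coeff q 0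
coeff1-⊗ []      q = sym (zeros (coeff q 1) (coeff q 0))
  where
  zeros : ∀ (u v : ℚ) → 0ℚ * u + 0ℚ * v ≡ 0ℚ
  zeros = solve-∀ ℚ-ring
coeff1-⊗ (a ∷ p) q = trans (coeff-⊕ (a ⊙ q) (0ℚ ∷ p ⊗ q) 1) (cong₂ _+_ (coeff-⊙ a q 1) (coeff0-⊗ p q))

coeff-[x+]^ : ∀ c m j → coeff ([x+ c ]^ m) j ≡ ℕ→ℚ (m C j) * c ^ℕ (m ∸ j)
coeff-[x+]^ c zero    zero    = refl
coeff-[x+]^ c zero    (suc j) = refl
coeff-[x+]^ c (suc m) zero    = begin
  coeff (c ⊙ [x+ c ]^ m ⊕ (0ℚ ∷ [x+ c ]^ m)) 0
                                    ≡⟨ coeff-⊕ (c ⊙ [x+ c ]^ m) (0ℚ ∷ [x+ c ]^ m) 0 ⟩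
  coeff (c ⊙ [x+ c ]^ m) 0 + 0ℚ     ≡⟨ cong (_+ 0ℚ) (trans (coeff-⊙ c ([x+ c ]^ m) 0) (cong (c *_) (coeff-[x+]^ c m 0))) ⟩
  c * (1ℚ * c ^ℕ m) + 0ℚ            ≡⟨ regroup c (c ^ℕ m) ⟩
  1ℚ * (c * c ^ℕ m)                 ∎
  where
  regroup : ∀ (c u : ℚ) → c * (1ℚ * u) + 0ℚ ≡ 1ℚ * (c * u)
  regroup = solve-∀ ℚ-ring
coeff-[x+]^ c (suc m) (suc j) = begin
  coeff (c ⊙ [x+ c ]^ m ⊕ (0ℚ ∷ [x+ c ]^ m)) (suc j)
    ≡⟨ coeff-⊕ (c ⊙ [x+ c ]^ m) (0ℚ ∷ [x+ c ]^ m) (suc j) ⟩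
  coeff (c ⊙ [x+ c ]^ m) (suc j) + coeff ([x+ c ]^ m) j
    ≡⟨ cong₂ _+_ (trans (coeff-⊙ c ([x+ c ]^ m) (suc j)) (cong (c *_) (coeff-[x+]^ c m (suc j)))) (coeff-[x+]^ c m j) ⟩
  c * (ℕ→ℚ (m C suc j) * c ^ℕ (m ∸ suc j)) + ℕ→ℚ (m C j) * c ^ℕ (m ∸ j)
    ≡⟨ cong (_+ ℕ→ℚ (m C j) * c ^ℕ (m ∸ j)) pascal-term ⟩
  ℕ→ℚ (m C suc j) * c ^ℕ (m ∸ j) + ℕ→ℚ (m C j) * c ^ℕ (m ∸ j)
    ≡⟨ ℚₚ.*-distribʳ-+ (c ^ℕ (m ∸ j)) (ℕ→ℚ (m C suc j)) (ℕ→ℚ (m C j)) ⟨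
  (ℕ→ℚ (m C suc j) + ℕ→ℚ (m C j)) * c ^ℕ (m ∸ j)
    ≡⟨ cong (_* c ^ℕ (m ∸ j)) (trans (ℚₚ.+-comm (ℕ→ℚ (m C suc j)) (ℕ→ℚ (m C j))) (sym (ℕ→ℚ-+ (m C j) (m C suc j)))) ⟩
  ℕ→ℚ (m C j ℕ.+ m C suc j) * c ^ℕ (m ∸ j)
    ≡⟨ cong (λ n → ℕ→ℚ n * c ^ℕ (m ∸ j)) (nCk+nC[k+1]≡[n+1]C[k+1] m j) ⟩
  ℕ→ℚ (suc m C suc j) * c ^ℕ (m ∸ j) ∎
  where
  swap : ∀ (c x u : ℚ) → c * (x * u) ≡ x * (c * u)
  swap = solve-∀ ℚ-ring
  pascal-term : c * (ℕ→ℚ (m C suc j) * c ^ℕ (m ∸ suc j)) ≡ ℕ→ℚ (m C suc j) * c ^ℕ (m ∸ j)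
  pascal-term with suc j ℕₚ.≤? m
  ... | yes j<m = trans (swap c (ℕ→ℚ (m C suc j)) (c ^ℕ (m ∸ suc j))) (cong (ℕ→ℚ (m C suc j) *_) (c*c^[m∸1+j]≡c^[m∸j] c j<m))
  ... | no  j≮m rewrite k>n⇒nCk≡0 (ℕₚ.≰⇒> j≮m) =
    trans (cong (c *_) (ℚₚ.*-zeroˡ (c ^ℕ (m ∸ suc j)))) (trans (ℚₚ.*-zeroʳ c) (sym (ℚₚ.*-zeroˡ (c ^ℕ (m ∸ j)))))

length-⊕ : ∀ p q → length (p ⊕ q) ≡ length p ⊔ length q
length-⊕ []      q       = refl
length-⊕ (a ∷ p) []      = refl
length-⊕ (a ∷ p) (b ∷ q) = cong suc (length-⊕ p q)

length-⊙ : ∀ c p → length (c ⊙ p) ≡ length p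
length-⊙ c []      = refl
length-⊙ c (a ∷ p) = cong suc (length-⊙ c p)

length-[x+]^ : ∀ c m → length ([x+ c ]^ m) ≡ suc m
length-[x+]^ c zero    = refl
length-[x+]^ c (suc m) = begin
  length (c ⊙ [x+ c ]^ m ⊕ (0ℚ ∷ [x+ c ]^ m))         ≡⟨ length-⊕ (c ⊙ [x+ c ]^ m) (0ℚ ∷ [x+ c ]^ m) ⟩
  length (c ⊙ [x+ c ]^ m) ⊔ suc (length ([x+ c ]^ m))  ≡⟨ cong (_⊔ suc (length ([x+ c ]^ m))) (length-⊙ c ([x+ c ]^ m)) ⟩
  length ([x+ c ]^ m) ⊔ suc (length ([x+ c ]^ m))      ≡⟨ ℕₚ.m≤n⇒m⊔n≡n (ℕₚ.n≤1+n (length ([x+ c ]^ m))) ⟩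
  suc (length ([x+ c ]^ m))                            ≡⟨ cong suc (length-[x+]^ c m) ⟩
  suc (suc m)                                          ∎

-- Λ b s is the linear functional xʲ ↦ b (s + j).
Λ : (ℕ → ℚ) → ℕ → Poly → ℚ
Λ b s []      = 0ℚ
Λ b s (a ∷ p) = a * b s + Λ b (suc s) p

Λ-⊕ : ∀ b s p q → Λ b s (p ⊕ q) ≡ Λ b s p + Λ b s q
Λ-⊕ b s []      q       = sym (ℚₚ.+-identityˡ _)
Λ-⊕ b s (a ∷ p) []      = sym (ℚₚ.+-identityʳ _)
Λ-⊕ b s (a ∷ p) (c ∷ q) =
  trans (cong (λ z → (a + c) * b s + z) (Λ-⊕ b (suc s) p q)) (regroup a c (b s) (Λ b (suc s) p) (Λ b (suc s) q))
  where
  regroup : ∀ (a c x u v : ℚ) → (a + c) * x + (u + v) ≡ (a * x + u) + (c * x + v)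
  regroup = solve-∀ ℚ-ring

Λ-⊙ : ∀ b s c p → Λ b s (c ⊙ p) ≡ c * Λ b s p
Λ-⊙ b s c []      = sym (ℚₚ.*-zeroʳ c)
Λ-⊙ b s c (a ∷ p) = trans (cong (λ z → c * a * b s + z) (Λ-⊙ b (suc s) c p)) (regroup c a (b s) (Λ b (suc s) p))
  where
  regroup : ∀ (c a x u : ℚ) → c * a * x + c * u ≡ c * (a * x + u)
  regroup = solve-∀ ℚ-ring

Λ-+ : ∀ b b′ s p → Λ (λ j → b j + b′ j) s p ≡ Λ b s p + Λ b′ s p
Λ-+ b b′ s []      = refl
Λ-+ b b′ s (a ∷ p) =
  trans (cong (λ z → a * (b s + b′ s) + z) (Λ-+ b b′ (suc s) p)) (regroup a (b s) (b′ s) (Λ b (suc s) p) (Λ b′ (suc s) p))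
  where
  regroup : ∀ (a x y u v : ℚ) → a * (x + y) + (u + v) ≡ (a * x + u) + (a * y + v)
  regroup = solve-∀ ℚ-ring

Λ-x^· : ∀ b s a p → Λ b s (x^ a · p) ≡ Λ b (s ℕ.+ a) p
Λ-x^· b s zero    p = cong (λ i → Λ b i p) (sym (ℕₚ.+-identityʳ s))
Λ-x^· b s (suc a) p = begin
  0ℚ * b s + Λ b (suc s) (x^ a · p)  ≡⟨ cong₂ _+_ (ℚₚ.*-zeroˡ (b s)) (Λ-x^· b (suc s) a p) ⟩
  0ℚ + Λ b (suc s ℕ.+ a) p           ≡⟨ ℚₚ.+-identityˡ _ ⟩
  Λ b (suc s ℕ.+ a) p                ≡⟨ cong (λ i → Λ b i p) (sym (ℕₚ.+-suc s a)) ⟩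
  Λ b (s ℕ.+ suc a) p                ∎

Λ-Σ< : ∀ b s p → Λ b s p ≡ Σ< (length p) (λ j → coeff p j * b (s ℕ.+ j))
Λ-Σ< b s []      = refl
Λ-Σ< b s (a ∷ p) = begin
  a * b s + Λ b (suc s) p
    ≡⟨ cong₂ (λ i z → a * b i + z) (sym (ℕₚ.+-identityʳ s)) (Λ-Σ< b (suc s) p) ⟩
  a * b (s ℕ.+ 0) + Σ< (length p) (λ j → coeff p j * b (suc s ℕ.+ j))
    ≡⟨ cong (λ z → a * b (s ℕ.+ 0) + z)
            (Σ<-cong (length p) (λ j _ → cong (λ i → coeff p j * b i) (sym (ℕₚ.+-suc s j)))) ⟩
  a * b (s ℕ.+ 0) + Σ< (length p) (λ j → coeff p j * b (s ℕ.+ suc j))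
    ≡⟨ Σ<-first (length p) (λ j → coeff (a ∷ p) j * b (s ℕ.+ j)) ⟨
  Σ< (suc (length p)) (λ j → coeff (a ∷ p) j * b (s ℕ.+ j)) ∎

Λ-[x+]^ : ∀ b s c m → Λ b s ([x+ c ]^ m) ≡ Σ< (suc m) (λ j → ℕ→ℚ (m C j) * c ^ℕ (m ∸ j) * b (s ℕ.+ j))
Λ-[x+]^ b s c m = begin
  Λ b s ([x+ c ]^ m)
    ≡⟨ Λ-Σ< b s ([x+ c ]^ m) ⟩
  Σ< (length ([x+ c ]^ m)) (λ j → coeff ([x+ c ]^ m) j * b (s ℕ.+ j))
    ≡⟨ cong (λ l → Σ< l (λ j → coeff ([x+ c ]^ m) j * b (s ℕ.+ j))) (length-[x+]^ c m) ⟩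
  Σ< (suc m) (λ j → coeff ([x+ c ]^ m) j * b (s ℕ.+ j))
    ≡⟨ Σ<-cong (suc m) (λ j _ → cong (_* b (s ℕ.+ j)) (coeff-[x+]^ c m j)) ⟩
  Σ< (suc m) (λ j → ℕ→ℚ (m C j) * c ^ℕ (m ∸ j) * b (s ℕ.+ j)) ∎

Λ-δ₁ : ∀ p → Λ δ₁ 0 p ≡ coeff p 1
Λ-δ₁ []          = refl
Λ-δ₁ (a ∷ [])    = trans (ℚₚ.+-identityʳ _) (ℚₚ.*-zeroʳ a)
Λ-δ₁ (a ∷ c ∷ p) = trans (cong₂ _+_ (ℚₚ.*-zeroʳ a) (cong₂ _+_ (ℚₚ.*-identityʳ c) (Λ-δ₁-beyond 0 p)))
                         (trans (ℚₚ.+-identityˡ _) (ℚₚ.+-identityʳ c))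
  where
  Λ-δ₁-beyond : ∀ s p → Λ δ₁ (suc (suc s)) p ≡ 0ℚ
  Λ-δ₁-beyond s []      = refl
  Λ-δ₁-beyond s (a ∷ p) = trans (cong₂ _+_ (ℚₚ.*-zeroʳ a) (Λ-δ₁-beyond (suc s) p)) (ℚₚ.+-identityʳ 0ℚ)

Λ-coeff≡0 : ∀ b s p → (∀ j → coeff p j ≡ 0ℚ) → Λ b s p ≡ 0ℚ
Λ-coeff≡0 b s []      zeros = refl
Λ-coeff≡0 b s (a ∷ p) zeros = begin
  a * b s + Λ b (suc s) p  ≡⟨ cong₂ (λ x z → x * b s + z) (zeros 0) (Λ-coeff≡0 b (suc s) p (zeros ∘ suc)) ⟩
  0ℚ * b s + 0ℚ            ≡⟨ cong (_+ 0ℚ) (ℚₚ.*-zeroˡ (b s)) ⟩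
  0ℚ + 0ℚ                  ≡⟨ ℚₚ.+-identityʳ 0ℚ ⟩
  0ℚ                       ∎

Λ-coeff-cong : ∀ b s p q → (∀ j → coeff p j ≡ coeff q j) → Λ b s p ≡ Λ b s q
Λ-coeff-cong b s []      q       eq = sym (Λ-coeff≡0 b s q (sym ∘ eq))
Λ-coeff-cong b s (a ∷ p) []      eq = Λ-coeff≡0 b s (a ∷ p) eq
Λ-coeff-cong b s (a ∷ p) (c ∷ q) eq = cong₂ (λ x z → x * b s + z) (eq 0) (Λ-coeff-cong b (suc s) p q (eq ∘ suc))

translateFrom : ℚ → ℕ → Poly → Poly
translateFrom c s []      = []
translateFrom c s (a ∷ p) = a ⊙ [x+ c ]^ s ⊕ translateFrom c (suc s) p

infixl 8 _∘[x+_]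
_∘[x+_] : Poly → ℚ → Poly
p ∘[x+ c ] = translateFrom c 0 p

eval-translateFrom : ∀ c s p y → eval (translateFrom c s p) y ≡ (y + c) ^ℕ s * eval p (y + c)
eval-translateFrom c s []      y = sym (ℚₚ.*-zeroʳ ((y + c) ^ℕ s))
eval-translateFrom c s (a ∷ p) y = begin
  eval (a ⊙ [x+ c ]^ s ⊕ translateFrom c (suc s) p) y
    ≡⟨ eval-⊕ (a ⊙ [x+ c ]^ s) (translateFrom c (suc s) p) y ⟩
  eval (a ⊙ [x+ c ]^ s) y + eval (translateFrom c (suc s) p) y
    ≡⟨ cong₂ _+_ (trans (eval-⊙ a ([x+ c ]^ s) y) (cong (a *_) (eval-[x+]^ c s y))) (eval-translateFrom c (suc s) p y) ⟩
  a * (y + c) ^ℕ s + (y + c) ^ℕ suc s * eval p (y + c)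
    ≡⟨ regroup a (y + c) ((y + c) ^ℕ s) (eval p (y + c)) ⟩
  (y + c) ^ℕ s * (a + (y + c) * eval p (y + c)) ∎
  where
  regroup : ∀ (a z u e : ℚ) → a * u + (z * u) * e ≡ u * (a + z * e)
  regroup = solve-∀ ℚ-ring

eval-∘[x+] : ∀ c p y → eval (p ∘[x+ c ]) y ≡ eval p (y + c)
eval-∘[x+] c p y = trans (eval-translateFrom c 0 p y) (ℚₚ.*-identityˡ _)

length-translateFrom : ∀ c s p → length (translateFrom c s p) ≤ s ℕ.+ length p
length-translateFrom c s []      = z≤n
length-translateFrom c s (a ∷ p) =
  subst₂ _≤_ (sym length-cons) (sym (ℕₚ.+-suc s (length p)))
    (ℕₚ.⊔-lub (s≤s (ℕₚ.m≤m+n s (length p))) (length-translateFrom c (suc s) p))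
  where
  length-cons : length (a ⊙ [x+ c ]^ s ⊕ translateFrom c (suc s) p) ≡ suc s ⊔ length (translateFrom c (suc s) p)
  length-cons = trans (length-⊕ (a ⊙ [x+ c ]^ s) (translateFrom c (suc s) p))
                      (cong (_⊔ length (translateFrom c (suc s) p)) (trans (length-⊙ a ([x+ c ]^ s)) (length-[x+]^ c s)))

Λ-translateFrom : ∀ {b b′ : ℕ → ℚ} c → (∀ s → Λ b 0 ([x+ c ]^ s) ≡ b′ s) →
                  ∀ s p → Λ b 0 (translateFrom c s p) ≡ Λ b′ s p
Λ-translateFrom {b} c Λb[x+c]^ s []      = refl
Λ-translateFrom {b} c Λb[x+c]^ s (a ∷ p) =
  trans (Λ-⊕ b 0 (a ⊙ [x+ c ]^ s) (translateFrom c (suc s) p))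
        (cong₂ _+_ (trans (Λ-⊙ b 0 a ([x+ c ]^ s)) (cong (a *_) (Λb[x+c]^ s)))
                   (Λ-translateFrom c Λb[x+c]^ (suc s) p))

reflectFrom : ℕ → Poly → Poly
reflectFrom s []      = []
reflectFrom s (a ∷ p) = (- 1ℚ) ^ℕ s * a ∷ reflectFrom (suc s) p

reflect : Poly → Poly
reflect = reflectFrom 0

eval-reflectFrom : ∀ s p y → eval (reflectFrom s p) y ≡ (- 1ℚ) ^ℕ s * eval p (- y)
eval-reflectFrom s []      y = sym (ℚₚ.*-zeroʳ ((- 1ℚ) ^ℕ s))
eval-reflectFrom s (a ∷ p) y =
  trans (cong (λ z → (- 1ℚ) ^ℕ s * a + y * z) (eval-reflectFrom (suc s) p y))
        (regroup ((- 1ℚ) ^ℕ s) a y (eval p (- y)))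
  where
  regroup : ∀ (u a y e : ℚ) → u * a + y * ((- 1ℚ * u) * e) ≡ u * (a + (- y) * e)
  regroup = solve-∀ ℚ-ring

eval-reflect : ∀ p y → eval (reflect p) y ≡ eval p (- y)
eval-reflect p y = trans (eval-reflectFrom 0 p y) (ℚₚ.*-identityˡ _)

coeff1-reflect : ∀ p → coeff (reflect p) 1 ≡ - coeff p 1
coeff1-reflect []          = refl
coeff1-reflect (a ∷ [])    = refl
coeff1-reflect (a ∷ c ∷ p) = sign c
  where
  sign : ∀ (c : ℚ) → - 1ℚ * 1ℚ * c ≡ - c
  sign = solve-∀ ℚ-ring

Λ-reflectFrom : ∀ {b b′ : ℕ → ℚ} → (∀ s → (- 1ℚ) ^ℕ s * b s ≡ b′ s) →
                ∀ s p → Λ b s (reflectFrom s p) ≡ Λ b′ s p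
Λ-reflectFrom {b} {b′} ±b s []      = refl
Λ-reflectFrom {b} {b′} ±b s (a ∷ p) =
  cong₂ _+_ (trans (regroup ((- 1ℚ) ^ℕ s) a (b s)) (cong (a *_) (±b s))) (Λ-reflectFrom ±b (suc s) p)
  where
  regroup : ∀ (u a x : ℚ) → u * a * x ≡ a * (u * x)
  regroup = solve-∀ ℚ-ring

coeff≡0⇒eval≡0 : ∀ p → (∀ j → coeff p j ≡ 0ℚ) → ∀ y → eval p y ≡ 0ℚ
coeff≡0⇒eval≡0 []      zeros y = refl
coeff≡0⇒eval≡0 (a ∷ p) zeros y = begin
  a + y * eval p y  ≡⟨ cong₂ (λ u v → u + y * v) (zeros 0) (coeff≡0⇒eval≡0 p (zeros ∘ suc) y) ⟩
  0ℚ + y * 0ℚ       ≡⟨ cong (λ z → 0ℚ + z) (ℚₚ.*-zeroʳ y) ⟩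
  0ℚ + 0ℚ           ≡⟨ ℚₚ.+-identityʳ 0ℚ ⟩
  0ℚ                ∎

-- The constant term is p(0); the tail q vanishes at every k + 1, so q ∘[x+ 1], which is no
-- longer than q, vanishes on ℕ and has zero coefficients by induction on the length bound.
eval-ℕ≡0⇒coeff≡0 : ∀ n p → length p ≤ n → (∀ k → eval p (ℕ→ℚ k) ≡ 0ℚ) → ∀ j → coeff p j ≡ 0ℚ
eval-ℕ≡0⇒coeff≡0 n       []      _           _     j = refl
eval-ℕ≡0⇒coeff≡0 (suc n) (a ∷ q) (s≤s |q|≤n) roots = λ where
    zero    → a≡0
    (suc j) → eval-ℕ≡0⇒coeff≡0 n q |q|≤n q-roots j
  where
  a+0*e : ∀ (a e : ℚ) → a + 0ℚ * e ≡ a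
  a+0*e = solve-∀ ℚ-ring
  y-1+1 : ∀ (y : ℚ) → y - 1ℚ + 1ℚ ≡ y
  y-1+1 = solve-∀ ℚ-ring

  a≡0 : a ≡ 0ℚ
  a≡0 = trans (sym (a+0*e a (eval q 0ℚ))) (roots 0)

  q-roots-suc : ∀ k → eval q (ℕ→ℚ (suc k)) ≡ 0ℚ
  q-roots-suc k = ℕ→ℚ-suc-*-cancelˡ k (begin
    ℕ→ℚ (suc k) * eval q (ℕ→ℚ (suc k))        ≡⟨ ℚₚ.+-identityˡ _ ⟨
    0ℚ + ℕ→ℚ (suc k) * eval q (ℕ→ℚ (suc k))   ≡⟨ cong (λ z → z + ℕ→ℚ (suc k) * eval q (ℕ→ℚ (suc k))) a≡0 ⟨
    eval (a ∷ q) (ℕ→ℚ (suc k))                ≡⟨ roots (suc k) ⟩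
    0ℚ                                         ≡⟨ ℚₚ.*-zeroʳ (ℕ→ℚ (suc k)) ⟨
    ℕ→ℚ (suc k) * 0ℚ                           ∎)

  shifted-coeffs : ∀ j → coeff (q ∘[x+ 1ℚ ]) j ≡ 0ℚ
  shifted-coeffs = eval-ℕ≡0⇒coeff≡0 n (q ∘[x+ 1ℚ ]) (ℕₚ.≤-trans (length-translateFrom 1ℚ 0 q) |q|≤n)
    (λ k → trans (eval-∘[x+] 1ℚ q (ℕ→ℚ k))
                 (trans (cong (eval q) (trans (ℚₚ.+-comm (ℕ→ℚ k) 1ℚ) (sym (ℕ→ℚ-suc k)))) (q-roots-suc k)))

  q-roots : ∀ k → eval q (ℕ→ℚ k) ≡ 0ℚ
  q-roots k = begin
    eval q (ℕ→ℚ k)                      ≡⟨ cong (eval q) (y-1+1 (ℕ→ℚ k)) ⟨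
    eval q (ℕ→ℚ k - 1ℚ + 1ℚ)            ≡⟨ eval-∘[x+] 1ℚ q (ℕ→ℚ k - 1ℚ) ⟨
    eval (q ∘[x+ 1ℚ ]) (ℕ→ℚ k - 1ℚ)     ≡⟨ coeff≡0⇒eval≡0 (q ∘[x+ 1ℚ ]) shifted-coeffs (ℕ→ℚ k - 1ℚ) ⟩
    0ℚ                                   ∎

eval≗⇒coeff≡ : ∀ p q → eval p ≗ eval q → ∀ j → coeff p j ≡ coeff q j
eval≗⇒coeff≡ p q p≗q j = begin
  coeff p j                                ≡⟨ split (coeff p j) (coeff q j) ⟩
  (coeff p j + - 1ℚ * coeff q j) + coeff q j
    ≡⟨ cong (_+ coeff q j) (trans (cong (λ z → coeff p j + z) (sym (coeff-⊙ (- 1ℚ) q j))) (sym (coeff-⊕ p (- 1ℚ ⊙ q) j))) ⟩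
  coeff d j + coeff q j                    ≡⟨ cong (_+ coeff q j) (eval-ℕ≡0⇒coeff≡0 (length d) d ℕₚ.≤-refl d-roots j) ⟩
  0ℚ + coeff q j                           ≡⟨ ℚₚ.+-identityˡ (coeff q j) ⟩
  coeff q j                                ∎
  where
  d : Poly
  d = p ⊕ - 1ℚ ⊙ q
  split : ∀ (x y : ℚ) → x ≡ (x + - 1ℚ * y) + y
  split = solve-∀ ℚ-ring
  e-e : ∀ (e : ℚ) → e + - 1ℚ * e ≡ 0ℚ
  e-e = solve-∀ ℚ-ring
  d-roots : ∀ k → eval d (ℕ→ℚ k) ≡ 0ℚ
  d-roots k = begin
    eval d (ℕ→ℚ k)                               ≡⟨ eval-⊕ p (- 1ℚ ⊙ q) (ℕ→ℚ k) ⟩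
    eval p (ℕ→ℚ k) + eval (- 1ℚ ⊙ q) (ℕ→ℚ k)     ≡⟨ cong₂ _+_ (p≗q (ℕ→ℚ k)) (eval-⊙ (- 1ℚ) q (ℕ→ℚ k)) ⟩
    eval q (ℕ→ℚ k) + - 1ℚ * eval q (ℕ→ℚ k)       ≡⟨ e-e (eval q (ℕ→ℚ k)) ⟩
    0ℚ                                            ∎

Λ-cong : ∀ b s p q → eval p ≗ eval q → Λ b s p ≡ Λ b s q
Λ-cong b s p q p≗q = Λ-coeff-cong b s p q (eval≗⇒coeff≡ p q p≗q)

-- Bernoulli numbers

-- `dotShift` is private to Defs. Abstracting the list and the index 0 in `recip-suc` makes
-- the unknown body below a pattern that unification solves as Defs' `dotShift`.
mutual
  dotShift : (ℕ → ℚ) → ℕ → List ℚ → ℚ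
  dotShift = _

  recip-suc : ∀ a n → recip a (suc n) ≡ - dotShift a 0 (recipList a n)
  recip-suc a n with recipList a n | 0
  ... | xs | p = refl

dotShift-recipList : ∀ a s n → dotShift a s (recipList a n) ≡ Σ< (suc n) (λ j → a (suc (s ℕ.+ j)) * recip a (n ∸ j))
dotShift-recipList a s zero    = begin
  a (suc s) * 1ℚ + 0ℚ            ≡⟨ cong (λ i → a (suc i) * 1ℚ + 0ℚ) (ℕₚ.+-identityʳ s) ⟨
  a (suc (s ℕ.+ 0)) * 1ℚ + 0ℚ    ≡⟨ ℚₚ.+-comm (a (suc (s ℕ.+ 0)) * 1ℚ) 0ℚ ⟩
  0ℚ + a (suc (s ℕ.+ 0)) * 1ℚ    ∎
dotShift-recipList a s (suc n) = begin
  a (suc s) * recip a (suc n) + dotShift a (suc s) (recipList a n)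
    ≡⟨ cong₂ (λ i z → a (suc i) * recip a (suc n) + z) (sym (ℕₚ.+-identityʳ s)) (dotShift-recipList a (suc s) n) ⟩
  a (suc (s ℕ.+ 0)) * recip a (suc n) + Σ< (suc n) (λ j → a (suc (suc s ℕ.+ j)) * recip a (n ∸ j))
    ≡⟨ cong (λ z → a (suc (s ℕ.+ 0)) * recip a (suc n) + z)
            (Σ<-cong (suc n) (λ j _ → cong (λ i → a (suc i) * recip a (n ∸ j)) (sym (ℕₚ.+-suc s j)))) ⟩
  a (suc (s ℕ.+ 0)) * recip a (suc n) + Σ< (suc n) (λ j → a (suc (s ℕ.+ suc j)) * recip a (n ∸ j))
    ≡⟨ Σ<-first (suc n) (λ j → a (suc (s ℕ.+ j)) * recip a (suc n ∸ j)) ⟨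
  Σ< (suc (suc n)) (λ j → a (suc (s ℕ.+ j)) * recip a (suc n ∸ j)) ∎

recip-convolution : ∀ a → a 0 ≡ 1ℚ → ∀ m → Σ< (suc (suc m)) (λ j → a j * recip a (suc m ∸ j)) ≡ 0ℚ
recip-convolution a a₀≡1 m = begin
  Σ< (suc (suc m)) (λ j → a j * recip a (suc m ∸ j))
    ≡⟨ Σ<-first (suc m) (λ j → a j * recip a (suc m ∸ j)) ⟩
  a 0 * recip a (suc m) + Σ< (suc m) (λ j → a (suc j) * recip a (m ∸ j))
    ≡⟨ cong₂ _+_ (trans (cong (_* recip a (suc m)) a₀≡1) (ℚₚ.*-identityˡ (recip a (suc m))))
                 (sym (dotShift-recipList a 0 m)) ⟩
  recip a (suc m) + dotShift a 0 (recipList a m)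
    ≡⟨ cong (_+ dotShift a 0 (recipList a m)) (recip-suc a m) ⟩
  - dotShift a 0 (recipList a m) + dotShift a 0 (recipList a m)
    ≡⟨ ℚₚ.+-inverseˡ (dotShift a 0 (recipList a m)) ⟩
  0ℚ ∎

binomial-B≡convolution-term : ∀ m i → i ≤ m →
  ℕ→ℚ (suc m C i) * B i ≡ ℕ→ℚ (suc m !) * (expm1-over-x (m ∸ i) * recip expm1-over-x i)
binomial-B≡convolution-term m i i≤m = sym (begin
  ℕ→ℚ (suc m !) * (e (m ∸ i) * b i)
    ≡⟨ cong (λ z → ℕ→ℚ z * (e (m ∸ i) * b i)) (nCk*k!*[n∸k]!≡n! (ℕₚ.m≤n⇒m≤1+n i≤m)) ⟨
  ℕ→ℚ ((suc m C i) ℕ.* (i ! ℕ.* (suc m ∸ i) !)) * (e (m ∸ i) * b i)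
    ≡⟨ cong (λ l → ℕ→ℚ ((suc m C i) ℕ.* (i ! ℕ.* l !)) * (e (m ∸ i) * b i)) (ℕₚ.+-∸-assoc 1 i≤m) ⟩
  ℕ→ℚ ((suc m C i) ℕ.* (i ! ℕ.* F)) * (e (m ∸ i) * b i)
    ≡⟨ cong (_* (e (m ∸ i) * b i)) (trans (ℕ→ℚ-* (suc m C i) (i ! ℕ.* F)) (cong (ℕ→ℚ (suc m C i) *_) (ℕ→ℚ-* (i !) F))) ⟩
  ℕ→ℚ (suc m C i) * (ℕ→ℚ (i !) * ℕ→ℚ F) * (e (m ∸ i) * b i)
    ≡⟨ regroup (ℕ→ℚ (suc m C i)) (ℕ→ℚ (i !)) (ℕ→ℚ F) (e (m ∸ i)) (b i) ⟩
  ℕ→ℚ (suc m C i) * (ℕ→ℚ (i !) * b i) * (ℕ→ℚ F * e (m ∸ i))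
    ≡⟨ cong (ℕ→ℚ (suc m C i) * B i *_) (ℕ→ℚ-*-1/ F {{suc (m ∸ i) ℕₚ.!≢0}}) ⟩
  ℕ→ℚ (suc m C i) * B i * 1ℚ
    ≡⟨ ℚₚ.*-identityʳ (ℕ→ℚ (suc m C i) * B i) ⟩
  ℕ→ℚ (suc m C i) * B i ∎)
  where
  e = expm1-over-x
  b = recip expm1-over-x
  F = suc (m ∸ i) !
  regroup : ∀ (c f g x y : ℚ) → c * (f * g) * (x * y) ≡ c * (f * y) * (g * x)
  regroup = solve-∀ ℚ-ring

bernoulli-recurrence : ∀ s → Σ< s (λ j → ℕ→ℚ (s C j) * B j) ≡ δ₁ s
bernoulli-recurrence zero          = refl
bernoulli-recurrence (suc zero)    = refl
bernoulli-recurrence (suc (suc m)) = begin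
  Σ< (suc (suc m)) (λ i → ℕ→ℚ (suc (suc m) C i) * B i)
    ≡⟨ Σ<-cong (suc (suc m)) (λ i i<2+m → binomial-B≡convolution-term (suc m) i (ℕₚ.≤-pred i<2+m)) ⟩
  Σ< (suc (suc m)) (λ i → ℕ→ℚ (suc (suc m) !) * (e (suc m ∸ i) * b i))
    ≡⟨ *-distribˡ-Σ< (suc (suc m)) (ℕ→ℚ (suc (suc m) !)) (λ i → e (suc m ∸ i) * b i) ⟨
  ℕ→ℚ (suc (suc m) !) * Σ< (suc (suc m)) (λ i → e (suc m ∸ i) * b i)
    ≡⟨ cong (ℕ→ℚ (suc (suc m) !) *_) (Σ<-reverse (suc m) (λ j i → e j * b i)) ⟨
  ℕ→ℚ (suc (suc m) !) * Σ< (suc (suc m)) (λ j → e j * b (suc m ∸ j))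
    ≡⟨ cong (ℕ→ℚ (suc (suc m) !) *_) (recip-convolution e refl m) ⟩
  ℕ→ℚ (suc (suc m) !) * 0ℚ
    ≡⟨ ℚₚ.*-zeroʳ (ℕ→ℚ (suc (suc m) !)) ⟩
  0ℚ ∎
  where
  e = expm1-over-x
  b = recip expm1-over-x

Λ-B-[x+1]^ : ∀ s → Λ B 0 ([x+ 1ℚ ]^ s) ≡ B s + δ₁ s
Λ-B-[x+1]^ s = begin
  Λ B 0 ([x+ 1ℚ ]^ s)
    ≡⟨ Λ-[x+]^ B 0 1ℚ s ⟩
  Σ< (suc s) (λ j → ℕ→ℚ (s C j) * 1ℚ ^ℕ (s ∸ j) * B j)
    ≡⟨ Σ<-cong (suc s) (λ j _ → cong (_* B j) (trans (cong (ℕ→ℚ (s C j) *_) (1^ℕ (s ∸ j))) (ℚₚ.*-identityʳ (ℕ→ℚ (s C j))))) ⟩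
  Σ< s (λ j → ℕ→ℚ (s C j) * B j) + ℕ→ℚ (s C s) * B s
    ≡⟨ cong₂ _+_ (bernoulli-recurrence s) (trans (cong (λ c → ℕ→ℚ c * B s) (nCn≡1 s)) (ℚₚ.*-identityˡ (B s))) ⟩
  δ₁ s + B s
    ≡⟨ ℚₚ.+-comm (δ₁ s) (B s) ⟩
  B s + δ₁ s ∎

Λ-B-∘[x+1] : ∀ p → Λ B 0 (p ∘[x+ 1ℚ ]) ≡ Λ B 0 p + coeff p 1
Λ-B-∘[x+1] p = begin
  Λ B 0 (p ∘[x+ 1ℚ ])               ≡⟨ Λ-translateFrom 1ℚ Λ-B-[x+1]^ 0 p ⟩
  Λ (λ s → B s + δ₁ s) 0 p          ≡⟨ Λ-+ B δ₁ 0 p ⟩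
  Λ B 0 p + Λ δ₁ 0 p                ≡⟨ cong (λ z → Λ B 0 p + z) (Λ-δ₁ p) ⟩
  Λ B 0 p + coeff p 1               ∎

-- Since (x - 1)ᴺ ∘[x+ 1] = xᴺ, Bᴺ = Σⱼ C(N,j) (-1)ᴺ⁻ʲ Bⱼ + N (-1)ᴺ⁻¹.
alternating-binomial-B : ∀ m → Σ< (suc m) (λ j → ℕ→ℚ (suc m C j) * ((- 1ℚ) ^ℕ j * B j)) ≡ ℕ→ℚ (suc m)
alternating-binomial-B m = cancel S X (ℕ→ℚ N) σB≡S+σB-N
  where
  N = suc m
  σ : ℕ → ℚ
  σ j = (- 1ℚ) ^ℕ j
  p = [x+ - 1ℚ ]^ N
  S = Σ< N (λ j → ℕ→ℚ (N C j) * (σ j * B j))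
  X = σ N * B N

  cancel : ∀ (s x n : ℚ) → x ≡ (s + x) + - n → s ≡ n
  cancel s x n eq = trans (rearrange s x n) (trans (cong (λ z → z - x + n) (sym eq)) (x-x+n x n))
    where
    rearrange : ∀ (s x n : ℚ) → s ≡ ((s + x) + - n) - x + n
    rearrange = solve-∀ ℚ-ring
    x-x+n : ∀ (x n : ℚ) → x - x + n ≡ n
    x-x+n = solve-∀ ℚ-ring
  y+1-1 : ∀ (y : ℚ) → y + 1ℚ + - 1ℚ ≡ y
  y+1-1 = solve-∀ ℚ-ring
  y^N : ∀ (y u : ℚ) → u ≡ u * (1ℚ + y * 0ℚ)
  y^N = solve-∀ ℚ-ring

  p∘[x+1]≗x^N : eval (p ∘[x+ 1ℚ ]) ≗ eval (x^ N · (1ℚ ∷ []))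
  p∘[x+1]≗x^N y = begin
    eval (p ∘[x+ 1ℚ ]) y         ≡⟨ eval-∘[x+] 1ℚ p y ⟩
    eval p (y + 1ℚ)              ≡⟨ eval-[x+]^ (- 1ℚ) N (y + 1ℚ) ⟩
    (y + 1ℚ + - 1ℚ) ^ℕ N         ≡⟨ cong (_^ℕ N) (y+1-1 y) ⟩
    y ^ℕ N                       ≡⟨ y^N y (y ^ℕ N) ⟩
    y ^ℕ N * (1ℚ + y * 0ℚ)       ≡⟨ eval-x^· N (1ℚ ∷ []) y ⟨
    eval (x^ N · (1ℚ ∷ [])) y    ∎

  B≡Λp+p′ : B N ≡ Λ B 0 p + coeff p 1
  B≡Λp+p′ = begin
    B N                              ≡⟨ trans (ℚₚ.+-identityʳ (1ℚ * B N)) (ℚₚ.*-identityˡ (B N)) ⟨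
    1ℚ * B N + 0ℚ                    ≡⟨ Λ-x^· B 0 N (1ℚ ∷ []) ⟨
    Λ B 0 (x^ N · (1ℚ ∷ []))         ≡⟨ Λ-cong B 0 (p ∘[x+ 1ℚ ]) (x^ N · (1ℚ ∷ [])) p∘[x+1]≗x^N ⟨
    Λ B 0 (p ∘[x+ 1ℚ ])              ≡⟨ Λ-B-∘[x+1] p ⟩
    Λ B 0 p + coeff p 1              ∎

  σΛp : σ N * Λ B 0 p ≡ S + X
  σΛp = begin
    σ N * Λ B 0 p
      ≡⟨ cong (σ N *_) (Λ-[x+]^ B 0 (- 1ℚ) N) ⟩
    σ N * Σ< (suc N) (λ j → ℕ→ℚ (N C j) * σ (N ∸ j) * B j)
      ≡⟨ *-distribˡ-Σ< (suc N) (σ N) (λ j → ℕ→ℚ (N C j) * σ (N ∸ j) * B j) ⟩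
    Σ< (suc N) (λ j → σ N * (ℕ→ℚ (N C j) * σ (N ∸ j) * B j))
      ≡⟨ Σ<-cong (suc N) (λ j j≤N → trans (regroup (σ N) (ℕ→ℚ (N C j)) (σ (N ∸ j)) (B j))
                                           (cong (λ z → ℕ→ℚ (N C j) * (z * B j)) (-1^ℕ-∸ (ℕₚ.≤-pred j≤N)))) ⟩
    S + ℕ→ℚ (N C N) * X
      ≡⟨ cong (λ c → S + ℕ→ℚ c * X) (nCn≡1 N) ⟩
    S + 1ℚ * X
      ≡⟨ cong (λ z → S + z) (ℚₚ.*-identityˡ X) ⟩
    S + X ∎
    where
    regroup : ∀ (w c u b : ℚ) → w * (c * u * b) ≡ c * ((w * u) * b)
    regroup = solve-∀ ℚ-ring

  σp′ : σ N * coeff p 1 ≡ - ℕ→ℚ N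
  σp′ = begin
    σ N * coeff p 1               ≡⟨ cong (σ N *_) (coeff-[x+]^ (- 1ℚ) N 1) ⟩
    σ N * (ℕ→ℚ (N C 1) * σ m)     ≡⟨ cong (λ c → σ N * (ℕ→ℚ c * σ m)) (nC1≡n N) ⟩
    σ N * (ℕ→ℚ N * σ m)           ≡⟨ signs (σ m) (ℕ→ℚ N) ⟩
    - ℕ→ℚ N * (σ m * σ m)         ≡⟨ cong (- ℕ→ℚ N *_) (-1^ℕ-square m) ⟩
    - ℕ→ℚ N * 1ℚ                  ≡⟨ ℚₚ.*-identityʳ (- ℕ→ℚ N) ⟩
    - ℕ→ℚ N                       ∎
    where
    signs : ∀ (u n : ℚ) → (- 1ℚ * u) * (n * u) ≡ - n * (u * u)
    signs = solve-∀ ℚ-ring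

  σB≡S+σB-N : X ≡ (S + X) + - ℕ→ℚ N
  σB≡S+σB-N = begin
    σ N * B N                                ≡⟨ cong (σ N *_) B≡Λp+p′ ⟩
    σ N * (Λ B 0 p + coeff p 1)              ≡⟨ ℚₚ.*-distribˡ-+ (σ N) (Λ B 0 p) (coeff p 1) ⟩
    σ N * Λ B 0 p + σ N * coeff p 1          ≡⟨ cong₂ _+_ σΛp σp′ ⟩
    (S + X) + - ℕ→ℚ N                        ∎

binomial-B+δ₁ : ∀ m → Σ< (suc m) (λ j → ℕ→ℚ (suc m C j) * (B j + δ₁ j)) ≡ ℕ→ℚ (suc m)
binomial-B+δ₁ m = begin
  Σ< (suc m) (λ j → ℕ→ℚ (suc m C j) * (B j + δ₁ j))
    ≡⟨ Σ<-cong (suc m) (λ j _ → ℚₚ.*-distribˡ-+ (ℕ→ℚ (suc m C j)) (B j) (δ₁ j)) ⟩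
  Σ< (suc m) (λ j → ℕ→ℚ (suc m C j) * B j + ℕ→ℚ (suc m C j) * δ₁ j)
    ≡⟨ Σ<-+ (suc m) (λ j → ℕ→ℚ (suc m C j) * B j) (λ j → ℕ→ℚ (suc m C j) * δ₁ j) ⟩
  Σ< (suc m) (λ j → ℕ→ℚ (suc m C j) * B j) + Σ< (suc m) (λ j → ℕ→ℚ (suc m C j) * δ₁ j)
    ≡⟨ cong (_+ Σ< (suc m) (λ j → ℕ→ℚ (suc m C j) * δ₁ j)) (bernoulli-recurrence (suc m)) ⟩
  δ₁ (suc m) + Σ< (suc m) (λ j → ℕ→ℚ (suc m C j) * δ₁ j)
    ≡⟨ δ₁-terms m ⟩
  ℕ→ℚ (suc m) ∎
  where
  δ₁-terms : ∀ m → δ₁ (suc m) + Σ< (suc m) (λ j → ℕ→ℚ (suc m C j) * δ₁ j) ≡ ℕ→ℚ (suc m)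
  δ₁-terms zero    = refl
  δ₁-terms (suc m) = trans (ℚₚ.+-identityˡ _)
    (trans (Σ<-δ₁ m (λ j → ℕ→ℚ (suc (suc m) C j))) (cong ℕ→ℚ (nC1≡n (suc (suc m)))))

-- Strong induction: both binomial sums above equal m + 1, and their terms below the top one agree.
bernoulli-parity : ∀ s → (- 1ℚ) ^ℕ s * B s ≡ B s + δ₁ s
bernoulli-parity = <-rec (λ s → (- 1ℚ) ^ℕ s * B s ≡ B s + δ₁ s) step
  where
  +-cancelˡ : ∀ (x a b : ℚ) → x + a ≡ x + b → a ≡ b
  +-cancelˡ x a b eq = trans (undo x a) (trans (cong (λ z → - x + z) eq) (sym (undo x b)))
    where
    undo : ∀ (x a : ℚ) → a ≡ - x + (x + a)
    undo = solve-∀ ℚ-ring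

  [1+m]Cm≡1+m : ∀ m → suc m C m ≡ suc m
  [1+m]Cm≡1+m m = trans (nCk≡nC[n∸k] (ℕₚ.n≤1+n m)) (trans (cong (suc m C_) (ℕₚ.m+n∸n≡m 1 m)) (nC1≡n (suc m)))

  step : ∀ m → (∀ {j} → j < m → (- 1ℚ) ^ℕ j * B j ≡ B j + δ₁ j) → (- 1ℚ) ^ℕ m * B m ≡ B m + δ₁ m
  step m IH = ℕ→ℚ-suc-*-cancelˡ m (begin
    ℕ→ℚ (suc m) * ((- 1ℚ) ^ℕ m * B m)        ≡⟨ cong (λ c → ℕ→ℚ c * ((- 1ℚ) ^ℕ m * B m)) ([1+m]Cm≡1+m m) ⟨
    ℕ→ℚ (suc m C m) * ((- 1ℚ) ^ℕ m * B m)    ≡⟨ +-cancelˡ (Σ< m shifted) (alternating m) (shifted m) top-terms ⟩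
    ℕ→ℚ (suc m C m) * (B m + δ₁ m)           ≡⟨ cong (λ c → ℕ→ℚ c * (B m + δ₁ m)) ([1+m]Cm≡1+m m) ⟩
    ℕ→ℚ (suc m) * (B m + δ₁ m)               ∎)
    where
    shifted alternating : ℕ → ℚ
    shifted j     = ℕ→ℚ (suc m C j) * (B j + δ₁ j)
    alternating j = ℕ→ℚ (suc m C j) * ((- 1ℚ) ^ℕ j * B j)
    top-terms : Σ< m shifted + alternating m ≡ Σ< m shifted + shifted m
    top-terms = begin
      Σ< m shifted + alternating m      ≡⟨ cong (_+ alternating m) (Σ<-cong m (λ j j<m → cong (ℕ→ℚ (suc m C j) *_) (IH j<m))) ⟨
      Σ< m alternating + alternating m  ≡⟨ alternating-binomial-B m ⟩
      ℕ→ℚ (suc m)                       ≡⟨ binomial-B+δ₁ m ⟨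
      Σ< m shifted + shifted m          ∎

Λ-B-reflect : ∀ p → Λ B 0 (reflect p) ≡ Λ B 0 p + coeff p 1
Λ-B-reflect p = begin
  Λ B 0 (reflect p)               ≡⟨ Λ-reflectFrom bernoulli-parity 0 p ⟩
  Λ (λ s → B s + δ₁ s) 0 p        ≡⟨ Λ-+ B δ₁ 0 p ⟩
  Λ B 0 p + Λ δ₁ 0 p              ≡⟨ cong (λ z → Λ B 0 p + z) (Λ-δ₁ p) ⟩
  Λ B 0 p + coeff p 1             ∎

-- The hypothesis a - c ≢ 0ℚ is needed only for n = 0, where the exponent n - 1 is negative.
slope-[x+a]^[1+n]⊗[x+a-c]^n : ∀ n a c → a - c ≢ 0ℚ →
  coeff ([x+ a ]^ suc n ⊗ [x+ a - c ]^ n) 1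
    ≡ (ℕ→ℚ (2 ℕ.* n ℕ.+ 1) * a - ℕ→ℚ (suc n) * c) * a ^ℕ n * (a - c) ^ℤ ((+ n) ℤ.- (+ 1))
slope-[x+a]^[1+n]⊗[x+a-c]^n n a c a-c≢0 = begin
  coeff ([x+ a ]^ suc n ⊗ [x+ a - c ]^ n) 1
    ≡⟨ coeff1-⊗ ([x+ a ]^ suc n) ([x+ a - c ]^ n) ⟩
  coeff ([x+ a ]^ suc n) 0 * coeff ([x+ a - c ]^ n) 1 + coeff ([x+ a ]^ suc n) 1 * coeff ([x+ a - c ]^ n) 0
    ≡⟨ cong₂ _+_ (cong₂ _*_ (coeff-[x+]^ a (suc n) 0) (coeff-[x+]^ (a - c) n 1))
                 (cong₂ _*_ (coeff-[x+]^ a (suc n) 1) (coeff-[x+]^ (a - c) n 0)) ⟩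
  (1ℚ * a ^ℕ suc n) * (ℕ→ℚ (n C 1) * (a - c) ^ℕ (n ∸ 1)) + (ℕ→ℚ (suc n C 1) * a ^ℕ n) * (1ℚ * (a - c) ^ℕ n)
    ≡⟨ cong₂ (λ i j → (1ℚ * a ^ℕ suc n) * (ℕ→ℚ i * (a - c) ^ℕ (n ∸ 1)) + (ℕ→ℚ j * a ^ℕ n) * (1ℚ * (a - c) ^ℕ n))
             (nC1≡n n) (nC1≡n (suc n)) ⟩
  (1ℚ * a ^ℕ suc n) * (ℕ→ℚ n * (a - c) ^ℕ (n ∸ 1)) + (ℕ→ℚ (suc n) * a ^ℕ n) * (1ℚ * (a - c) ^ℕ n)
    ≡⟨ closed-form n ⟩
  (ℕ→ℚ (2 ℕ.* n ℕ.+ 1) * a - ℕ→ℚ (suc n) * c) * a ^ℕ n * (a - c) ^ℤ ((+ n) ℤ.- (+ 1)) ∎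
  where
  closed-form : ∀ d → (1ℚ * a ^ℕ suc d) * (ℕ→ℚ d * (a - c) ^ℕ (d ∸ 1)) + (ℕ→ℚ (suc d) * a ^ℕ d) * (1ℚ * (a - c) ^ℕ d)
                    ≡ (ℕ→ℚ (2 ℕ.* d ℕ.+ 1) * a - ℕ→ℚ (suc d) * c) * a ^ℕ d * (a - c) ^ℤ ((+ d) ℤ.- (+ 1))
  closed-form zero = begin
    (1ℚ * (a * 1ℚ)) * (0ℚ * 1ℚ) + (1ℚ * 1ℚ) * (1ℚ * 1ℚ)
      ≡⟨ constant a ⟩
    1ℚ
      ≡⟨ ^ℤ-inverse (a - c) 0 (λ eq → a-c≢0 (trans (sym (ℚₚ.*-identityʳ (a - c))) eq)) ⟨
    (a - c) ^ℕ 1 * (a - c) ^ℤ -[1+ 0 ]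
      ≡⟨ cong (_* (a - c) ^ℤ -[1+ 0 ]) (regroup a c) ⟩
    (1ℚ * a - 1ℚ * c) * 1ℚ * (a - c) ^ℤ -[1+ 0 ] ∎
    where
    constant : ∀ (a : ℚ) → (1ℚ * (a * 1ℚ)) * (0ℚ * 1ℚ) + (1ℚ * 1ℚ) * (1ℚ * 1ℚ) ≡ 1ℚ
    constant = solve-∀ ℚ-ring
    regroup : ∀ (a c : ℚ) → (a - c) * 1ℚ ≡ (1ℚ * a - 1ℚ * c) * 1ℚ
    regroup = solve-∀ ℚ-ring
  closed-form (suc m) = begin
    (1ℚ * a ^ℕ suc (suc m)) * (N * (a - c) ^ℕ m) + (ℕ→ℚ (suc (suc m)) * a ^ℕ suc m) * (1ℚ * (a - c) ^ℕ suc m)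
      ≡⟨ cong (λ z → (1ℚ * a ^ℕ suc (suc m)) * (N * (a - c) ^ℕ m) + (z * a ^ℕ suc m) * (1ℚ * (a - c) ^ℕ suc m))
              (ℕ→ℚ-suc (suc m)) ⟩
    (1ℚ * a ^ℕ suc (suc m)) * (N * (a - c) ^ℕ m) + ((1ℚ + N) * a ^ℕ suc m) * (1ℚ * (a - c) ^ℕ suc m)
      ≡⟨ regroup a c N (a ^ℕ m) ((a - c) ^ℕ m) ⟩
    ((ℕ→ℚ 2 * N + 1ℚ) * a - (1ℚ + N) * c) * a ^ℕ suc m * (a - c) ^ℕ m
      ≡⟨ cong₂ (λ u v → (u * a - v * c) * a ^ℕ suc m * (a - c) ^ℕ m) (ℕ→ℚ-2n+1 (suc m)) (ℕ→ℚ-suc (suc m)) ⟨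
    (ℕ→ℚ (2 ℕ.* suc m ℕ.+ 1) * a - ℕ→ℚ (suc (suc m)) * c) * a ^ℕ suc m * (a - c) ^ℕ m ∎
    where
    N : ℚ
    N = ℕ→ℚ (suc m)
    regroup : ∀ (a c N p q : ℚ) →
      (1ℚ * (a * (a * p))) * (N * q) + ((1ℚ + N) * (a * p)) * (1ℚ * ((a - c) * q))
        ≡ ((ℕ→ℚ 2 * N + 1ℚ) * a - (1ℚ + N) * c) * (a * p) * q
    regroup = solve-∀ ℚ-ring

-- The main computation

summand : ℕ → ℕ → ℕ → ℚ
summand n k i = (ℕ→ℚ (2 ℕ.* n ℕ.+ 1) * ℕ→ℚ i - ℕ→ℚ (suc n) * ℕ→ℚ k) * ℕ→ℚ i ^ℕ n * (ℕ→ℚ i - ℕ→ℚ k) ^ℤ ((+ n) ℤ.- (+ 1))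

module _ (k n : ℕ) where

  private
    K : ℚ
    K = ℕ→ℚ k

  g h : Poly
  g = x^ suc n · [x+ K ]^ n
  h = x^ n · [x+ K ]^ suc n

  W : ℕ → Poly
  W i = [x+ ℕ→ℚ i ]^ suc n ⊗ [x+ ℕ→ℚ i - K ]^ n

  LHS≡Λg+Λh : LHS k n ≡ Λ B 0 g + Λ B 0 h
  LHS≡Λg+Λh = begin
    LHS k n                                       ≡⟨⟩
    (+ 1 / suc n) * Σ< (suc (suc n)) term          ≡⟨ cong ((+ 1 / suc n) *_) Σterm≡ ⟩
    (+ 1 / suc n) * (ℕ→ℚ (suc n) * (Σv + Σu))     ≡⟨ regroup (+ 1 / suc n) (ℕ→ℚ (suc n)) (Σv + Σu) ⟩
    ℕ→ℚ (suc n) * (+ 1 / suc n) * (Σv + Σu)       ≡⟨ cong (_* (Σv + Σu)) (ℕ→ℚ-*-1/ (suc n)) ⟩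
    1ℚ * (Σv + Σu)                                ≡⟨ ℚₚ.*-identityˡ (Σv + Σu) ⟩
    Σv + Σu                                       ≡⟨ cong₂ _+_ Λg≡Σv Λh≡Σu ⟨
    Λ B 0 g + Λ B 0 h                             ∎
    where
    term u v : ℕ → ℚ
    term i = K ^ℕ (suc n ∸ i) * ℕ→ℚ (suc n C i) * B̃ (n ℕ.+ i)
    u j = ℕ→ℚ (suc n C j) * K ^ℕ (suc n ∸ j) * B (n ℕ.+ j)
    v j = ℕ→ℚ (n C j) * K ^ℕ (n ∸ j) * B (suc n ℕ.+ j)
    Σu = Σ< (suc (suc n)) u
    Σv = Σ< (suc n) v

    regroup : ∀ (x y z : ℚ) → x * (y * z) ≡ y * x * z
    regroup = solve-∀ ℚ-ring

    Λh≡Σu : Λ B 0 h ≡ Σu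
    Λh≡Σu = trans (Λ-x^· B 0 n ([x+ K ]^ suc n)) (Λ-[x+]^ B n K (suc n))

    Λg≡Σv : Λ B 0 g ≡ Σv
    Λg≡Σv = trans (Λ-x^· B 0 (suc n) ([x+ K ]^ n)) (Λ-[x+]^ B (suc n) K n)

    term≡ : ∀ i → term i ≡ ℕ→ℚ (suc n) * u i + ℕ→ℚ i * u i
    term≡ i = trans (cong (λ z → K ^ℕ (suc n ∸ i) * ℕ→ℚ (suc n C i) * (z * B (n ℕ.+ i))) (ℕ→ℚ-+ (suc n) i))
                    (spread (K ^ℕ (suc n ∸ i)) (ℕ→ℚ (suc n C i)) (ℕ→ℚ (suc n)) (ℕ→ℚ i) (B (n ℕ.+ i)))
      where
      spread : ∀ (a c s i b : ℚ) → a * c * ((s + i) * b) ≡ s * (c * a * b) + i * (c * a * b)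
      spread = solve-∀ ℚ-ring

    [1+j]u[1+j] : ∀ j → ℕ→ℚ (suc j) * u (suc j) ≡ ℕ→ℚ (suc n) * v j
    [1+j]u[1+j] j = begin
      ℕ→ℚ (suc j) * (ℕ→ℚ (suc n C suc j) * K ^ℕ (n ∸ j) * B (n ℕ.+ suc j))
        ≡⟨ regroup′ (ℕ→ℚ (suc j)) (ℕ→ℚ (suc n C suc j)) (K ^ℕ (n ∸ j)) (B (n ℕ.+ suc j)) ⟩
      ℕ→ℚ (suc j) * ℕ→ℚ (suc n C suc j) * K ^ℕ (n ∸ j) * B (n ℕ.+ suc j)
        ≡⟨ cong₂ (λ z i → z * K ^ℕ (n ∸ j) * B i) absorb (ℕₚ.+-suc n j) ⟩
      ℕ→ℚ (suc n) * ℕ→ℚ (n C j) * K ^ℕ (n ∸ j) * B (suc n ℕ.+ j)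
        ≡⟨ regroup′ (ℕ→ℚ (suc n)) (ℕ→ℚ (n C j)) (K ^ℕ (n ∸ j)) (B (suc n ℕ.+ j)) ⟨
      ℕ→ℚ (suc n) * v j ∎
      where
      regroup′ : ∀ (j c a b : ℚ) → j * (c * a * b) ≡ j * c * a * b
      regroup′ = solve-∀ ℚ-ring
      absorb : ℕ→ℚ (suc j) * ℕ→ℚ (suc n C suc j) ≡ ℕ→ℚ (suc n) * ℕ→ℚ (n C j)
      absorb = trans (sym (ℕ→ℚ-* (suc j) (suc n C suc j)))
                     (trans (cong ℕ→ℚ ([1+k]*[1+n]C[1+k]≡[1+n]*nCk n j)) (ℕ→ℚ-* (suc n) (n C j)))

    Σi*u≡ : Σ< (suc (suc n)) (λ i → ℕ→ℚ i * u i) ≡ ℕ→ℚ (suc n) * Σv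
    Σi*u≡ = begin
      Σ< (suc (suc n)) (λ i → ℕ→ℚ i * u i)
        ≡⟨ Σ<-first (suc n) (λ i → ℕ→ℚ i * u i) ⟩
      0ℚ * u 0 + Σ< (suc n) (λ j → ℕ→ℚ (suc j) * u (suc j))
        ≡⟨ cong₂ _+_ (ℚₚ.*-zeroˡ (u 0)) (Σ<-cong (suc n) (λ j _ → [1+j]u[1+j] j)) ⟩
      0ℚ + Σ< (suc n) (λ j → ℕ→ℚ (suc n) * v j)
        ≡⟨ ℚₚ.+-identityˡ _ ⟩
      Σ< (suc n) (λ j → ℕ→ℚ (suc n) * v j)
        ≡⟨ *-distribˡ-Σ< (suc n) (ℕ→ℚ (suc n)) v ⟨
      ℕ→ℚ (suc n) * Σv ∎

    Σterm≡ : Σ< (suc (suc n)) term ≡ ℕ→ℚ (suc n) * (Σv + Σu)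
    Σterm≡ = begin
      Σ< (suc (suc n)) term
        ≡⟨ Σ<-cong (suc (suc n)) (λ i _ → term≡ i) ⟩
      Σ< (suc (suc n)) (λ i → ℕ→ℚ (suc n) * u i + ℕ→ℚ i * u i)
        ≡⟨ Σ<-+ (suc (suc n)) (λ i → ℕ→ℚ (suc n) * u i) (λ i → ℕ→ℚ i * u i) ⟩
      Σ< (suc (suc n)) (λ i → ℕ→ℚ (suc n) * u i) + Σ< (suc (suc n)) (λ i → ℕ→ℚ i * u i)
        ≡⟨ cong₂ _+_ (sym (*-distribˡ-Σ< (suc (suc n)) (ℕ→ℚ (suc n)) u)) Σi*u≡ ⟩
      ℕ→ℚ (suc n) * Σu + ℕ→ℚ (suc n) * Σv
        ≡⟨ ℚₚ.+-comm (ℕ→ℚ (suc n) * Σu) (ℕ→ℚ (suc n) * Σv) ⟩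
      ℕ→ℚ (suc n) * Σv + ℕ→ℚ (suc n) * Σu
        ≡⟨ ℚₚ.*-distribˡ-+ (ℕ→ℚ (suc n)) Σv Σu ⟨
      ℕ→ℚ (suc n) * (Σv + Σu) ∎

  eval-W : ∀ i y → eval (W i) y ≡ (y + ℕ→ℚ i) ^ℕ suc n * (y + (ℕ→ℚ i - K)) ^ℕ n
  eval-W i y = trans (eval-⊗ ([x+ ℕ→ℚ i ]^ suc n) ([x+ ℕ→ℚ i - K ]^ n) y)
                     (cong₂ _*_ (eval-[x+]^ (ℕ→ℚ i) (suc n) y) (eval-[x+]^ (ℕ→ℚ i - K) n y))

  Λh≡ΛW : Λ B 0 h ≡ Λ B 0 (W k)
  Λh≡ΛW = Λ-cong B 0 h (W k) λ y → begin
    eval h y                                      ≡⟨ eval-x^· n ([x+ K ]^ suc n) y ⟩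
    y ^ℕ n * eval ([x+ K ]^ suc n) y              ≡⟨ cong (y ^ℕ n *_) (eval-[x+]^ K (suc n) y) ⟩
    y ^ℕ n * (y + K) ^ℕ suc n                     ≡⟨ ℚₚ.*-comm (y ^ℕ n) ((y + K) ^ℕ suc n) ⟩
    (y + K) ^ℕ suc n * y ^ℕ n                     ≡⟨ cong (λ z → (y + K) ^ℕ suc n * z ^ℕ n) (y+[K-K] y K) ⟨
    (y + K) ^ℕ suc n * (y + (K - K)) ^ℕ n         ≡⟨ eval-W k y ⟨
    eval (W k) y                                  ∎
    where
    y+[K-K] : ∀ (y K : ℚ) → y + (K - K) ≡ y
    y+[K-K] = solve-∀ ℚ-ring

  ΛW-suc : ∀ i → Λ B 0 (W (suc i)) ≡ Λ B 0 (W i) + coeff (W i) 1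
  ΛW-suc i = trans (sym (Λ-cong B 0 (W i ∘[x+ 1ℚ ]) (W (suc i)) W∘[x+1]≗W-suc)) (Λ-B-∘[x+1] (W i))
    where
    shift₁ : ∀ (y I : ℚ) → y + 1ℚ + I ≡ y + (1ℚ + I)
    shift₁ = solve-∀ ℚ-ring
    shift₂ : ∀ (y I K : ℚ) → y + 1ℚ + (I - K) ≡ y + ((1ℚ + I) - K)
    shift₂ = solve-∀ ℚ-ring
    W∘[x+1]≗W-suc : eval (W i ∘[x+ 1ℚ ]) ≗ eval (W (suc i))
    W∘[x+1]≗W-suc y = begin
      eval (W i ∘[x+ 1ℚ ]) y
        ≡⟨ eval-∘[x+] 1ℚ (W i) y ⟩
      eval (W i) (y + 1ℚ)
        ≡⟨ eval-W i (y + 1ℚ) ⟩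
      (y + 1ℚ + ℕ→ℚ i) ^ℕ suc n * (y + 1ℚ + (ℕ→ℚ i - K)) ^ℕ n
        ≡⟨ cong₂ (λ a b → a ^ℕ suc n * b ^ℕ n)
                 (trans (shift₁ y (ℕ→ℚ i)) (cong (λ z → y + z) (sym (ℕ→ℚ-suc i))))
                 (trans (shift₂ y (ℕ→ℚ i) K) (cong (λ z → y + (z - K)) (sym (ℕ→ℚ-suc i)))) ⟩
      (y + ℕ→ℚ (suc i)) ^ℕ suc n * (y + (ℕ→ℚ (suc i) - K)) ^ℕ n
        ≡⟨ eval-W (suc i) y ⟨
      eval (W (suc i)) y ∎

  ΛW-telescope : ∀ i → Λ B 0 (W i) ≡ Λ B 0 (W 0) + Σ< i (λ j → coeff (W j) 1)
  ΛW-telescope zero    = sym (ℚₚ.+-identityʳ _)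
  ΛW-telescope (suc i) = begin
    Λ B 0 (W (suc i))                                               ≡⟨ ΛW-suc i ⟩
    Λ B 0 (W i) + coeff (W i) 1                                     ≡⟨ cong (_+ coeff (W i) 1) (ΛW-telescope i) ⟩
    Λ B 0 (W 0) + Σ< i (λ j → coeff (W j) 1) + coeff (W i) 1        ≡⟨ ℚₚ.+-assoc (Λ B 0 (W 0)) _ _ ⟩
    Λ B 0 (W 0) + Σ< (suc i) (λ j → coeff (W j) 1)                  ∎

  reflect-g≗-W₀ : eval (reflect g) ≗ eval (- 1ℚ ⊙ W 0)
  reflect-g≗-W₀ y = begin
    eval (reflect g) y
      ≡⟨ eval-reflect g y ⟩
    eval g (- y)
      ≡⟨ eval-x^· (suc n) ([x+ K ]^ n) (- y) ⟩
    (- y) ^ℕ suc n * eval ([x+ K ]^ n) (- y)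
      ≡⟨ cong ((- y) ^ℕ suc n *_) (eval-[x+]^ K n (- y)) ⟩
    (- y) ^ℕ suc n * (- y + K) ^ℕ n
      ≡⟨ cong₂ (λ a b → a ^ℕ suc n * b ^ℕ n) (-y≡ y) (-y+K≡ y K) ⟩
    (- 1ℚ * (y + 0ℚ)) ^ℕ suc n * (- 1ℚ * (y + (0ℚ - K))) ^ℕ n
      ≡⟨ cong₂ _*_ (^ℕ-distrib-* (- 1ℚ) (y + 0ℚ) (suc n)) (^ℕ-distrib-* (- 1ℚ) (y + (0ℚ - K)) n) ⟩
    ((- 1ℚ) ^ℕ suc n * (y + 0ℚ) ^ℕ suc n) * ((- 1ℚ) ^ℕ n * (y + (0ℚ - K)) ^ℕ n)
      ≡⟨ signs ((- 1ℚ) ^ℕ n) ((y + 0ℚ) ^ℕ suc n) ((y + (0ℚ - K)) ^ℕ n) ⟩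
    - 1ℚ * ((y + 0ℚ) ^ℕ suc n * (y + (0ℚ - K)) ^ℕ n) * ((- 1ℚ) ^ℕ n * (- 1ℚ) ^ℕ n)
      ≡⟨ cong (- 1ℚ * ((y + 0ℚ) ^ℕ suc n * (y + (0ℚ - K)) ^ℕ n) *_) (-1^ℕ-square n) ⟩
    - 1ℚ * ((y + 0ℚ) ^ℕ suc n * (y + (0ℚ - K)) ^ℕ n) * 1ℚ
      ≡⟨ ℚₚ.*-identityʳ _ ⟩
    - 1ℚ * ((y + 0ℚ) ^ℕ suc n * (y + (0ℚ - K)) ^ℕ n)
      ≡⟨ cong (- 1ℚ *_) (eval-W 0 y) ⟨
    - 1ℚ * eval (W 0) y
      ≡⟨ eval-⊙ (- 1ℚ) (W 0) y ⟨
    eval (- 1ℚ ⊙ W 0) y ∎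
    where
    -y≡ : ∀ (y : ℚ) → - y ≡ - 1ℚ * (y + 0ℚ)
    -y≡ = solve-∀ ℚ-ring
    -y+K≡ : ∀ (y K : ℚ) → - y + K ≡ - 1ℚ * (y + (0ℚ - K))
    -y+K≡ = solve-∀ ℚ-ring
    signs : ∀ (s a b : ℚ) → (- 1ℚ * s * a) * (s * b) ≡ - 1ℚ * (a * b) * (s * s)
    signs = solve-∀ ℚ-ring

  Λg+ΛW₀+W₀′≡0 : Λ B 0 g + Λ B 0 (W 0) + coeff (W 0) 1 ≡ 0ℚ
  Λg+ΛW₀+W₀′≡0 = cancel (Λ B 0 g) (Λ B 0 (W 0)) (coeff g 1) (coeff (W 0) 1) (Λ B 0 (reflect g))
    (Λ-B-reflect g)
    (trans (Λ-cong B 0 (reflect g) (- 1ℚ ⊙ W 0) reflect-g≗-W₀) (Λ-⊙ B 0 (- 1ℚ) (W 0)))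
    g′≡W₀′
    where
    cancel : ∀ (G w γ c r : ℚ) → r ≡ G + γ → r ≡ - 1ℚ * w → γ ≡ c → G + w + c ≡ 0ℚ
    cancel G w γ c r r≡G+γ r≡-w γ≡c = trans (regroup G w c) (trans (cong (_+ w) (trans (cong (λ z → G + z) (sym γ≡c)) (trans (sym r≡G+γ) r≡-w))) (-w+w w))
      where
      regroup : ∀ (G w c : ℚ) → G + w + c ≡ G + c + w
      regroup = solve-∀ ℚ-ring
      -w+w : ∀ (w : ℚ) → - 1ℚ * w + w ≡ 0ℚ
      -w+w = solve-∀ ℚ-ring
    x≡-[-x] : ∀ (x : ℚ) → x ≡ - (- x)
    x≡-[-x] = solve-∀ ℚ-ring
    -[-1*x]≡x : ∀ (x : ℚ) → - (- 1ℚ * x) ≡ x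
    -[-1*x]≡x = solve-∀ ℚ-ring
    g′≡W₀′ : coeff g 1 ≡ coeff (W 0) 1
    g′≡W₀′ = begin
      coeff g 1                        ≡⟨ x≡-[-x] (coeff g 1) ⟩
      - (- coeff g 1)                  ≡⟨ cong -_ (coeff1-reflect g) ⟨
      - coeff (reflect g) 1            ≡⟨ cong -_ (eval≗⇒coeff≡ (reflect g) (- 1ℚ ⊙ W 0) reflect-g≗-W₀ 1) ⟩
      - coeff (- 1ℚ ⊙ W 0) 1           ≡⟨ cong -_ (coeff-⊙ (- 1ℚ) (W 0) 1) ⟩
      - (- 1ℚ * coeff (W 0) 1)         ≡⟨ -[-1*x]≡x (coeff (W 0) 1) ⟩
      coeff (W 0) 1                    ∎

  coeff1-W : ∀ i → i < k → coeff (W i) 1 ≡ summand n k i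
  coeff1-W i i<k = slope-[x+a]^[1+n]⊗[x+a-c]^n n (ℕ→ℚ i) K i-k≢0
    where
    split : ∀ (x y : ℚ) → x ≡ (x - y) + y
    split = solve-∀ ℚ-ring
    i-k≢0 : ℕ→ℚ i - K ≢ 0ℚ
    i-k≢0 eq = ℕₚ.<-irrefl (ℕ→ℚ-injective (trans (split (ℕ→ℚ i) K) (trans (cong (_+ K) eq) (ℚₚ.+-identityˡ K)))) i<k

LHS≡Σsummand : ∀ k n → LHS (suc k) n ≡ Σ< k (λ j → summand n (suc k) (suc j))
LHS≡Σsummand k n = begin
  LHS (suc k) n
    ≡⟨ LHS≡Λg+Λh (suc k) n ⟩
  Λg + Λ B 0 (h (suc k) n)
    ≡⟨ cong (λ z → Λg + z) (trans (Λh≡ΛW (suc k) n) (ΛW-telescope (suc k) n (suc k))) ⟩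
  Λg + (ΛW₀ + Σ< (suc k) c)
    ≡⟨ cong (λ z → Λg + (ΛW₀ + z)) (Σ<-first k c) ⟩
  Λg + (ΛW₀ + (c 0 + Σ< k (c ∘ suc)))
    ≡⟨ regroup Λg ΛW₀ (c 0) (Σ< k (c ∘ suc)) ⟩
  Λg + ΛW₀ + c 0 + Σ< k (c ∘ suc)
    ≡⟨ cong (_+ Σ< k (c ∘ suc)) (Λg+ΛW₀+W₀′≡0 (suc k) n) ⟩
  0ℚ + Σ< k (c ∘ suc)
    ≡⟨ ℚₚ.+-identityˡ (Σ< k (c ∘ suc)) ⟩
  Σ< k (c ∘ suc)
    ≡⟨ Σ<-cong k (λ j j<k → coeff1-W (suc k) n (suc j) (s≤s j<k)) ⟩
  Σ< k (λ j → summand n (suc k) (suc j)) ∎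
  where
  Λg ΛW₀ : ℚ
  Λg  = Λ B 0 (g (suc k) n)
  ΛW₀ = Λ B 0 (W (suc k) n 0)
  c : ℕ → ℚ
  c j = coeff (W (suc k) n j) 1
  regroup : ∀ (a b c d : ℚ) → a + (b + (c + d)) ≡ a + b + c + d
  regroup = solve-∀ ℚ-ring

-- The cases k = 2, 3, 4

summand-suc : ∀ m k i {p q} → ℕ→ℚ i ^ℕ m ≡ p → (ℕ→ℚ i - ℕ→ℚ k) ^ℕ m ≡ q →
  summand (suc m) k i ≡ ((ℕ→ℚ 2 * ℕ→ℚ (suc m) + 1ℚ) * ℕ→ℚ i - (1ℚ + ℕ→ℚ (suc m)) * ℕ→ℚ k) * (ℕ→ℚ i * p) * q
summand-suc m k i refl refl =
  cong₂ (λ a b → (a * ℕ→ℚ i - b * ℕ→ℚ k) * (ℕ→ℚ i * ℕ→ℚ i ^ℕ m) * (ℕ→ℚ i - ℕ→ℚ k) ^ℕ m)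
        (ℕ→ℚ-2n+1 (suc m)) (ℕ→ℚ-suc (suc m))

LHS-2 : ∀ n → LHS 2 n ≡ (- 1ℚ) ^ℕ n
LHS-2 zero    = refl
LHS-2 (suc m) = begin
  LHS 2 (suc m)                             ≡⟨ LHS≡Σsummand 1 (suc m) ⟩
  0ℚ + summand (suc m) 2 1                  ≡⟨ cong (λ z → 0ℚ + z) (summand-suc m 2 1 (1^ℕ m) refl) ⟩
  0ℚ + (c₁ * 1ℚ - (1ℚ + N) * ℕ→ℚ 2) * (1ℚ * 1ℚ) * s  ≡⟨ identity N s ⟩
  - 1ℚ * s                                  ∎
  where
  N = ℕ→ℚ (suc m)
  c₁ = ℕ→ℚ 2 * N + 1ℚ
  s = (- 1ℚ) ^ℕ m
  identity : ∀ (N s : ℚ) → 0ℚ + ((ℕ→ℚ 2 * N + 1ℚ) * 1ℚ - (1ℚ + N) * ℕ→ℚ 2) * (1ℚ * 1ℚ) * s ≡ - 1ℚ * s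
  identity = solve-∀ ℚ-ring

LHS-3 : ∀ n → LHS 3 n ≡ (- ℕ→ℚ 2) ^ℤ ((+ n) ℤ.- (+ 1)) * (ℕ→ℚ n - ℕ→ℚ 4)
LHS-3 zero    = refl
LHS-3 (suc m) = begin
  LHS 3 (suc m)
    ≡⟨ LHS≡Σsummand 2 (suc m) ⟩
  0ℚ + summand (suc m) 3 1 + summand (suc m) 3 2
    ≡⟨ cong₂ (λ a b → 0ℚ + a + b) (summand-suc m 3 1 (1^ℕ m) (^ℕ-distrib-* (- 1ℚ) (ℕ→ℚ 2) m))
                                  (summand-suc m 3 2 refl refl) ⟩
  0ℚ + (c₁ * 1ℚ - c₂ * ℕ→ℚ 3) * (1ℚ * 1ℚ) * (s * t) + (c₁ * ℕ→ℚ 2 - c₂ * ℕ→ℚ 3) * (ℕ→ℚ 2 * t) * s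
    ≡⟨ identity N s t ⟩
  (s * t) * (N - ℕ→ℚ 4)
    ≡⟨ cong (_* (N - ℕ→ℚ 4)) (^ℕ-distrib-* (- 1ℚ) (ℕ→ℚ 2) m) ⟨
  (- ℕ→ℚ 2) ^ℕ m * (N - ℕ→ℚ 4) ∎
  where
  N = ℕ→ℚ (suc m)
  c₁ = ℕ→ℚ 2 * N + 1ℚ
  c₂ = 1ℚ + N
  s = (- 1ℚ) ^ℕ m
  t = ℕ→ℚ 2 ^ℕ m
  identity : ∀ (N s t : ℚ) →
    0ℚ + ((ℕ→ℚ 2 * N + 1ℚ) * 1ℚ - (1ℚ + N) * ℕ→ℚ 3) * (1ℚ * 1ℚ) * (s * t)
       + ((ℕ→ℚ 2 * N + 1ℚ) * ℕ→ℚ 2 - (1ℚ + N) * ℕ→ℚ 3) * (ℕ→ℚ 2 * t) * s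
    ≡ (s * t) * (N - ℕ→ℚ 4)
  identity = solve-∀ ℚ-ring

LHS-4 : ∀ n → LHS 4 n ≡ (- 1ℚ) ^ℕ n * (ℕ→ℚ 4 ^ℕ n + (ℕ→ℚ 2 - ((+ 4) / 3) * ℕ→ℚ n) * ℕ→ℚ 3 ^ℕ n)
LHS-4 zero    = refl
LHS-4 (suc m) = begin
  LHS 4 (suc m)
    ≡⟨ LHS≡Σsummand 3 (suc m) ⟩
  0ℚ + summand (suc m) 4 1 + summand (suc m) 4 2 + summand (suc m) 4 3
    ≡⟨ cong₃ (λ a b c → 0ℚ + a + b + c)
             (summand-suc m 4 1 (1^ℕ m) (^ℕ-distrib-* (- 1ℚ) (ℕ→ℚ 3) m))
             (summand-suc m 4 2 refl (^ℕ-distrib-* (- 1ℚ) (ℕ→ℚ 2) m))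
             (summand-suc m 4 3 refl refl) ⟩
  0ℚ + (c₁ * 1ℚ - c₂ * ℕ→ℚ 4) * (1ℚ * 1ℚ) * (s * r)
     + (c₁ * ℕ→ℚ 2 - c₂ * ℕ→ℚ 4) * (ℕ→ℚ 2 * t) * (s * t)
     + (c₁ * ℕ→ℚ 3 - c₂ * ℕ→ℚ 4) * (ℕ→ℚ 3 * r) * s
    ≡⟨ identity N s t r ⟩
  (- 1ℚ * s) * (ℕ→ℚ 4 * (t * t) + (ℕ→ℚ 2 - ((+ 4) / 3) * N) * (ℕ→ℚ 3 * r))
    ≡⟨ cong (λ z → (- 1ℚ * s) * (ℕ→ℚ 4 * z + (ℕ→ℚ 2 - ((+ 4) / 3) * N) * (ℕ→ℚ 3 * r)))
            (^ℕ-distrib-* (ℕ→ℚ 2) (ℕ→ℚ 2) m) ⟨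
  (- 1ℚ) ^ℕ suc m * (ℕ→ℚ 4 ^ℕ suc m + (ℕ→ℚ 2 - ((+ 4) / 3) * N) * ℕ→ℚ 3 ^ℕ suc m) ∎
  where
  N = ℕ→ℚ (suc m)
  c₁ = ℕ→ℚ 2 * N + 1ℚ
  c₂ = 1ℚ + N
  s = (- 1ℚ) ^ℕ m
  t = ℕ→ℚ 2 ^ℕ m
  r = ℕ→ℚ 3 ^ℕ m
  cong₃ : ∀ (f : ℚ → ℚ → ℚ → ℚ) {a a′ b b′ c c′} → a ≡ a′ → b ≡ b′ → c ≡ c′ → f a b c ≡ f a′ b′ c′
  cong₃ f refl refl refl = refl
  identity : ∀ (N s t r : ℚ) →
    0ℚ + ((ℕ→ℚ 2 * N + 1ℚ) * 1ℚ - (1ℚ + N) * ℕ→ℚ 4) * (1ℚ * 1ℚ) * (s * r)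
       + ((ℕ→ℚ 2 * N + 1ℚ) * ℕ→ℚ 2 - (1ℚ + N) * ℕ→ℚ 4) * (ℕ→ℚ 2 * t) * (s * t)
       + ((ℕ→ℚ 2 * N + 1ℚ) * ℕ→ℚ 3 - (1ℚ + N) * ℕ→ℚ 4) * (ℕ→ℚ 3 * r) * s
    ≡ (- 1ℚ * s) * (ℕ→ℚ 4 * (t * t) + (ℕ→ℚ 2 - ((+ 4) / 3) * N) * (ℕ→ℚ 3 * r))
  identity = solve-∀ ℚ-ring

theorem7p3 : (n : ℕ) →
    (LHS 2 n ≡ (- 1ℚ) ^ℕ n)
    × (LHS 3 n ≡ (- ℕ→ℚ 2) ^ℤ ((+ n) ℤ.- (+ 1)) * (ℕ→ℚ n - ℕ→ℚ 4))
    × (LHS 4 n ≡ (- 1ℚ) ^ℕ n * (ℕ→ℚ 4 ^ℕ n + (ℕ→ℚ 2 - ((+ 4) / 3) * ℕ→ℚ n) * ℕ→ℚ 3 ^ℕ n))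
    × ((k : ℕ) → 1 ≤ k →
        LHS k n ≡ ΣFromTo 1 (k ℕ.∸ 1) (λ i →
          (ℕ→ℚ (2 ℕ.* n ℕ.+ 1) * ℕ→ℚ i - ℕ→ℚ (suc n) * ℕ→ℚ k)
          * ℕ→ℚ i ^ℕ n * (ℕ→ℚ i - ℕ→ℚ k) ^ℤ ((+ n) ℤ.- (+ 1))))
theorem7p3 n = LHS-2 n , LHS-3 n , LHS-4 n , general
  where
  general : (k : ℕ) → 1 ≤ k → LHS k n ≡ ΣFromTo 1 (k ∸ 1) (summand n k)
  general (suc k) _ = LHS≡Σsummand k n
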